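{- The fragment $\mathrm{3LQST_0}^R$ enjoys a small model property: there is a computable function $f$ such that every satisfiable $\mathrm{3LQST_0}^R$-formula $\psi$ is satisfied by a $\mathrm{3LQST_0}$-interpretation whose domain is finite with at most $f(\psi)$ elements, where $f(\psi)$ depends only on $\psi$ (on its length). Consequently, the satisfiability problem for $\mathrm{3LQST_0}^R$ is decidable.
   Context: The language $\mathrm{3LQST_0}$ has three sorts of variables: individual variables $x,y,z,\dots\in\mathcal V_0$, set variables $X,Y,Z,\dots\in\mathcal V_1$, and collection variables $A,B,C,\dots\in\mathcal V_2$, together with finite enumerations $\{x_1,\dots,x_k\}$ with $x_1,\dots,x_k\in\mathcal V_0$, $k>0$. Quantifier-free atomic formulae of level 0 are $x=y$, $x\in X$, $\{x_1,\dots,x_k\}=X$, $\{x_1,\dots,x_k\}\in A$; those of level 1 are $X=Y$, $X\in A$. A purely universal formula of level 0 is $(\forall z_1)\dots(\forall z_n)\varphi_0$ with $n\ge1$, $z_i\in\mathcal V_0$, and $\varphi_0$ a propositional combination of level-0 quantifier-free atoms. A purely universal formula of level 1 is $(\forall Z_1)\dots(\forall Z_m)\varphi_1$ with $m\ge 1$, $Z_j\in\mathcal V_1$, and $\varphi_1$ a propositional combination of quantifier-free atoms of any level and of purely universal formulae of level 0. The $\mathrm{3LQST_0}$-formulae are the propositional combinations of quantifier-free atoms and of purely universal formulae of levels 0 and 1. An interpretation is a pair $(D,M)$ with $D$ a nonempty set, $Mx\in D$ for $x\in\mathcal V_0$, $MX\subseteq D$ for $X\in\mathcal V_1$, $MA\subseteq\mathrm{pow}(D)$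 for $A\in\mathcal V_2$; $\{x_1,\dots,x_k\}$ is interpreted as $\{Mx_1,\dots,Mx_k\}$, $=$ and $\in$ have their standard meaning, $(\forall z)$ ranges over $D$ and $(\forall Z)$ ranges over subsets of $D$, and connectives are classical. The fragment $\mathrm{3LQST_0}^R$ consists of those $\mathrm{3LQST_0}$-formulae $\psi$ such that for every purely universal level-1 formula $(\forall Z_1)\dots(\forall Z_m)\varphi_1$ occurring in $\psi$ and every purely universal level-0 formula $(\forall z_1)\dots(\forall z_n)\varphi_0$ occurring in $\varphi_1$, the formula $\neg\varphi_0\rightarrow\bigwedge_{i=1}^n\bigwedge_{j=1}^m z_i\in Z_j$ is valid (true in all interpretations). -}

module Defs where

open import Level using (Level; Lift; lift; 0ℓ) renaming (suc to lsuc)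
open import Data.Nat using (ℕ; zero; suc; _+_; _≤_; _≟_)
open import Data.Bool using (Bool; true; false)
open import Data.List using (List; []; _∷_; _++_; concatMap; length; sum; map)
open import Data.List.NonEmpty using (List⁺; _∷_; toList; foldr₁) renaming (map to map⁺; length to length⁺)
open import Data.List.Relation.Unary.Any using (Any)
open import Data.List.Membership.Propositional using (_∈_)
open import Data.Product using (Σ; _×_; _,_)
open import Data.Sum using (_⊎_)
open import Data.Empty using (⊥)
open import Data.Fin using (Fin)
open import Function.Bundles using (_↔_)
open import Relation.Nullary using (¬_; yes; no)
open import Relation.Binary.PropositionalEquality using (_≡_)

-- Syntax of 3LQST0.
-- Individual, set and collection variables are all named by natural
-- numbers (three disjoint name spaces, distinguished by position).

Var0 Var1 Var2 : Set
Var0 = ℕ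
Var1 = ℕ
Var2 = ℕ

data PC (At : Set) : Set where
  atom : At → PC At
  neg  : PC At → PC At
  and  : PC At → PC At → PC At
  or   : PC At → PC At → PC At
  imp  : PC At → PC At → PC At
  iff  : PC At → PC At → PC At

mapPC : {A B : Set} → (A → B) → PC A → PC B
mapPC f (atom a)  = atom (f a)
mapPC f (neg p)   = neg (mapPC f p)
mapPC f (and p q) = and (mapPC f p) (mapPC f q)
mapPC f (or p q)  = or (mapPC f p) (mapPC f q)
mapPC f (imp p q) = imp (mapPC f p) (mapPC f q)
mapPC f (iff p q) = iff (mapPC f p) (mapPC f q)

atomsPC : {A : Set} → PC A → List A
atomsPC (atom a)  = a ∷ []
atomsPC (neg p)   = atomsPC p
atomsPC (and p q) = atomsPC p ++ atomsPC q
atomsPC (or p q)  = atomsPC p ++ atomsPC q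
atomsPC (imp p q) = atomsPC p ++ atomsPC q
atomsPC (iff p q) = atomsPC p ++ atomsPC q

-- Quantifier-free atomic formulae of level 0:
--   x = y,  x ∈ X,  {x1,...,xk} = X,  {x1,...,xk} ∈ A   (k > 0)
data Atom0 : Set where
  eq0    : Var0 → Var0 → Atom0
  mem0   : Var0 → Var1 → Atom0
  enumEq : List⁺ Var0 → Var1 → Atom0
  enumIn : List⁺ Var0 → Var2 → Atom0

data Atom1 : Set where
  eq1  : Var1 → Var1 → Atom1
  mem1 : Var1 → Var2 → Atom1

record U0 : Set where
  constructor ∀₀
  field
    zs   : List⁺ Var0
    body : PC Atom0

data L1Atom : Set where
  l1-a0 : Atom0 → L1Atom
  l1-a1 : Atom1 → L1Atom
  l1-u0 : U0 → L1Atom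

record U1 : Set where
  constructor ∀₁
  field
    Zs   : List⁺ Var1
    body : PC L1Atom

data FAtom : Set where
  f-a0 : Atom0 → FAtom
  f-a1 : Atom1 → FAtom
  f-u0 : U0 → FAtom
  f-u1 : U1 → FAtom

Formula : Set
Formula = PC FAtom

-- An interpretation (D, M): D nonempty (witnessed by an element),
-- subsets of D are predicates D → Set, collections are predicates on
-- predicates.
record Interp : Set₁ where
  field
    D    : Set
    elt  : D
    M0   : Var0 → D
    M1   : Var1 → (D → Set)
    M2   : Var2 → ((D → Set) → Set)

open Interp

_≐_ : {D : Set} → (D → Set) → (D → Set) → Set
S ≐ T = ∀ d → (S d → T d) × (T d → S d)

enumSet : {D : Set} → (Var0 → D) → List⁺ Var0 → D → Set
enumSet M xs d = Any (λ x → d ≡ M x) (toList xs)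

-- Membership of a subset in a collection (collections are sets of
-- subsets, so membership is up to extensional equality of subsets).
_∈C_ : {D : Set} → (D → Set) → ((D → Set) → Set) → Set₁
S ∈C C = Σ _ λ T → C T × (T ≐ S)

upd : {a : Level} {A : Set a} → (ℕ → A) → ℕ → A → ℕ → A
upd f x a y with x ≟ y
... | yes _ = a
... | no  _ = f y

evalPC : {At : Set} → (At → Set₁) → PC At → Set₁
evalPC v (atom a)  = v a
evalPC v (neg p)   = ¬ evalPC v p
evalPC v (and p q) = evalPC v p × evalPC v q
evalPC v (or p q)  = evalPC v p ⊎ evalPC v q
evalPC v (imp p q) = evalPC v p → evalPC v q
evalPC v (iff p q) = (evalPC v p → evalPC v q) × (evalPC v q → evalPC v p)

withM0 : (I : Interp) → (Var0 → D I) → Interp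
withM0 I m = record { D = D I ; elt = elt I ; M0 = m ; M1 = M1 I ; M2 = M2 I }

withM1 : (I : Interp) → (Var1 → (D I → Set)) → Interp
withM1 I m = record { D = D I ; elt = elt I ; M0 = M0 I ; M1 = m ; M2 = M2 I }

⟦_⟧a0 : Atom0 → Interp → Set₁
⟦ eq0 x y ⟧a0 I     = Lift _ (M0 I x ≡ M0 I y)
⟦ mem0 x X ⟧a0 I    = Lift _ (M1 I X (M0 I x))
⟦ enumEq xs X ⟧a0 I = Lift _ (enumSet (M0 I) xs ≐ M1 I X)
⟦ enumIn xs A ⟧a0 I = enumSet (M0 I) xs ∈C M2 I A

⟦_⟧a1 : Atom1 → Interp → Set₁
⟦ eq1 X Y ⟧a1 I  = Lift _ (M1 I X ≐ M1 I Y)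
⟦ mem1 X A ⟧a1 I = M1 I X ∈C M2 I A

forall0 : List Var0 → (Interp → Set₁) → Interp → Set₁
forall0 []       P I = P I
forall0 (z ∷ zs) P I = ∀ (d : D I) → forall0 zs P (withM0 I (upd (M0 I) z d))

forall1 : List Var1 → (Interp → Set₁) → Interp → Set₁
forall1 []       P I = P I
forall1 (Z ∷ Zs) P I = ∀ (S : D I → Set) → forall1 Zs P (withM1 I (upd (M1 I) Z S))

⟦_⟧u0 : U0 → Interp → Set₁
⟦ ∀₀ zs φ ⟧u0 = forall0 (toList zs) (λ J → evalPC (λ a → ⟦ a ⟧a0 J) φ)

⟦_⟧l1 : L1Atom → Interp → Set₁
⟦ l1-a0 a ⟧l1 = ⟦ a ⟧a0
⟦ l1-a1 a ⟧l1 = ⟦ a ⟧a1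
⟦ l1-u0 u ⟧l1 = ⟦ u ⟧u0

⟦_⟧u1 : U1 → Interp → Set₁
⟦ ∀₁ Zs φ ⟧u1 = forall1 (toList Zs) (λ J → evalPC (λ a → ⟦ a ⟧l1 J) φ)

⟦_⟧fa : FAtom → Interp → Set₁
⟦ f-a0 a ⟧fa = ⟦ a ⟧a0
⟦ f-a1 a ⟧fa = ⟦ a ⟧a1
⟦ f-u0 u ⟧fa = ⟦ u ⟧u0
⟦ f-u1 u ⟧fa = ⟦ u ⟧u1

_⊨_ : Interp → Formula → Set₁
I ⊨ ψ = evalPC (λ a → ⟦ a ⟧fa I) ψ

Satisfiable : Formula → Set₁
Satisfiable ψ = Σ Interp λ I → I ⊨ ψ

Valid : Formula → Set₁
Valid ψ = (I : Interp) → I ⊨ ψ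

SatisfiableWithin : ℕ → Formula → Set₁
SatisfiableWithin b ψ =
  Σ Interp λ I → Σ ℕ λ n → n ≤ b × (D I ↔ Fin n) × I ⊨ ψ

u1sOf : Formula → List U1
u1sOf ψ = concatMap pick (atomsPC ψ)
  where
  pick : FAtom → List U1
  pick (f-u1 u) = u ∷ []
  pick _        = []

u0sOf : U1 → List U0
u0sOf (∀₁ _ φ) = concatMap pick (atomsPC φ)
  where
  pick : L1Atom → List U0
  pick (l1-u0 u) = u ∷ []
  pick _         = []

bigAnd : List⁺ Formula → Formula
bigAnd = foldr₁ and

rCondition : U1 → U0 → Formula
rCondition (∀₁ Zs _) (∀₀ zs φ0) =
  imp (neg (mapPC f-a0 φ0))
      (bigAnd (Data.List.NonEmpty.concatMap
                 (λ z → map⁺ (λ Z → atom (f-a0 (mem0 z Z))) Zs) zs))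

InR : Formula → Set₁
InR ψ = ∀ u1 → u1 ∈ u1sOf ψ → ∀ u0 → u0 ∈ u0sOf u1 → Valid (rCondition u1 u0)

sizePC : {At : Set} → (At → ℕ) → PC At → ℕ
sizePC s (atom a)  = s a
sizePC s (neg p)   = 1 + sizePC s p
sizePC s (and p q) = 1 + sizePC s p + sizePC s q
sizePC s (or p q)  = 1 + sizePC s p + sizePC s q
sizePC s (imp p q) = 1 + sizePC s p + sizePC s q
sizePC s (iff p q) = 1 + sizePC s p + sizePC s q

sizeA0 : Atom0 → ℕ
sizeA0 (eq0 _ _)     = 3
sizeA0 (mem0 _ _)    = 3
sizeA0 (enumEq xs _) = 4 + length⁺ xs
sizeA0 (enumIn xs _) = 4 + length⁺ xs

sizeU0 : U0 → ℕ
sizeU0 (∀₀ zs φ) = 2 * length⁺ zs + sizePC sizeA0 φ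
  where open Data.Nat using (_*_)

sizeL1 : L1Atom → ℕ
sizeL1 (l1-a0 a) = sizeA0 a
sizeL1 (l1-a1 _) = 3
sizeL1 (l1-u0 u) = sizeU0 u

sizeFA : FAtom → ℕ
sizeFA (f-a0 a) = sizeA0 a
sizeFA (f-a1 _) = 3
sizeFA (f-u0 u) = sizeU0 u
sizeFA (f-u1 (∀₁ Zs φ)) = 2 * length⁺ Zs + sizePC sizeL1 φ
  where open Data.Nat using (_*_)

size : Formula → ℕ
size = sizePC sizeFA

module Submission where

-- From a model I of ψ we keep finitely many points: the values
-- of the individual variables, |ψ|+1 points of every relevant subset (values
-- of set variables and sets of refutations of level-1 formulae), a point
-- separating any two relevant subsets, and the points of refutations of the
-- level-0 formulae, also at every assignment of relevant subsets to set
-- quantifiers (§7).  A subset of the small domain is read back in I as the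
-- relevant subset it restricts, if any, and as itself otherwise.  A transfer
-- theorem (§4) shows that such an embedding preserves truth once every false
-- universal formula has a refutation inside the image; the 3LQST0^R
-- restriction (§2) provides these refutations when a quantified set is not
-- relevant.  Decidability (§8-9): finite models are coded by finite data,
-- truth in a code is decidable, and ψ is satisfiable iff some code within
-- the size bound satisfies it.  Excluded middle is used only in proofs.

open import Defs
open import Level using (lift; lower; 0ℓ; _⊔_) renaming (suc to lsuc)
open import Axiom.ExcludedMiddle using (ExcludedMiddle)
open import Data.Nat as ℕ using (ℕ; zero; suc; _+_; _*_; _^_; _≤_; z≤n; s≤s)
open import Data.Nat.Properties
  using (≤-refl; ≤-reflexive; ≤-trans; <-irrefl; ≮⇒≥; m≤m+n; m≤n+m; +-mono-≤; *-mono-≤; *-monoʳ-≤;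
         *-monoˡ-≤; ^-monoˡ-≤; ^-monoʳ-≤; *-distribˡ-+; *-identityˡ; +-identityʳ; n≤1+n)
open import Data.Nat.ListAction using (sum)
open import Data.Nat.ListAction.Properties using (sum-++)
open import Data.Bool using (Bool; true; false; T)
open import Data.Fin using (Fin; zero; suc)
import Data.Vec.Functional as V
import Data.Fin.Properties as Fin
open import Data.List using (List; []; _∷_; _++_; concatMap; length; map; lookup; filter; deduplicate; allFin; upTo)
open import Data.List.Properties using (length-++; length-map; map-++; length-deduplicate)
open import Data.List.NonEmpty using (List⁺; _∷_; toList) renaming (length to length⁺)
open import Data.List.NonEmpty.Properties using (toList->>=)
import Data.List.NonEmpty
open import Data.List.Relation.Unary.Any as Any using (Any; here; there)
open import Data.List.Relation.Unary.Any.Properties using (lookup-index; map⁺)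
open import Data.List.Relation.Unary.All as All using (All; []; _∷_)
open import Data.List.Relation.Unary.All.Properties using (¬Any⇒All¬)
open import Data.List.Relation.Unary.Unique.Propositional using (Unique; []; _∷_)
open import Data.List.Relation.Unary.Unique.DecPropositional.Properties using (deduplicate-!)
open import Data.List.Membership.Propositional using (_∈_; _∉_; find; lose)
open import Data.List.Membership.Propositional.Properties
  using (∈-++⁺ˡ; ∈-++⁺ʳ; ∈-map⁺; ∈-lookup; ∈-concatMap⁺; ∈-filter⁺; ∈-filter⁻;
         ∈-deduplicate⁺; ∈-allFin; ∈-upTo⁺)
open import Data.List.Membership.DecPropositional ℕ._≟_ using (_∈?_)
open import Data.Product using (Σ; _×_; _,_; proj₁; proj₂)
open import Data.Sum using (_⊎_; inj₁; inj₂)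
open import Data.Empty using (⊥; ⊥-elim)
open import Data.Unit using (⊤; tt)
open import Function using (_∘_)
open import Function.Bundles using (_↔_; Inverse; mk↔ₛ′)
open import Relation.Nullary using (¬_; Dec; yes; no; does)
open import Relation.Nullary.Decidable using (True; toWitness; fromWitness; map′; ¬?; _×-dec_; _⊎-dec_; _→-dec_; dec-true)
open import Relation.Nullary.Decidable.Core using (T?; isYes)
open import Relation.Binary.PropositionalEquality using (_≡_; _≢_; refl; sym; trans; cong; cong₂; subst; subst₂)

open Interp

infix 2 _⇔_
_⇔_ : ∀ {a b} → Set a → Set b → Set (a ⊔ b)
A ⇔ B = (A → B) × (B → A)

byContradiction : ExcludedMiddle (lsuc 0ℓ) → {P : Set₁} → ¬ ¬ P → P
byContradiction em {P} ¬¬p with em {P}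
... | yes p = p
... | no ¬p = ⊥-elim (¬¬p ¬p)

byContradiction₀ : ExcludedMiddle 0ℓ → {P : Set} → ¬ ¬ P → P
byContradiction₀ em {P} ¬¬p with em {P}
... | yes p = p
... | no ¬p = ⊥-elim (¬¬p ¬p)

≐-refl : {D : Set} {S : D → Set} → S ≐ S
≐-refl d = (λ x → x) , (λ x → x)

≐-sym : {D : Set} {S T : D → Set} → S ≐ T → T ≐ S
≐-sym h d = proj₂ (h d) , proj₁ (h d)

≐-trans : {D : Set} {S T U : D → Set} → S ≐ T → T ≐ U → S ≐ U
≐-trans h k d = (λ x → proj₁ (k d) (proj₁ (h d) x)) , (λ x → proj₂ (h d) (proj₂ (k d) x))

≡⇒≐ : {D : Set} {S T : D → Set} → S ≡ T → S ≐ T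
≡⇒≐ refl = ≐-refl

∈C-resp : {D : Set} {S S' : D → Set} {C : (D → Set) → Set} → S ≐ S' → S ∈C C → S' ∈C C
∈C-resp h (T , c , t) = T , c , ≐-trans t h

upd-pointwise : ∀ {a b r} {A : Set a} {B : Set b} (R : A → B → Set r) {f : ℕ → A} {g : ℕ → B} z x {u v} →
  R u v → (z ≢ x → R (f x) (g x)) → R (upd f z u x) (upd g z v x)
upd-pointwise R z x ruv rfg with z ℕ.≟ x
... | yes _ = ruv
... | no z≢x = rfg z≢x

upd-other : ∀ {a} {A : Set a} (f : ℕ → A) z u {x} → z ≢ x → upd f z u x ≡ f x
upd-other f z u {x} z≢x with z ℕ.≟ x
... | yes z≡x = ⊥-elim (z≢x z≡x)
... | no _    = refl

Agree : ∀ {a} {A : Set a} → List ℕ → (ℕ → A) → (ℕ → A) → Set a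
Agree zs g f = ∀ x → x ∉ zs → g x ≡ f x

pullback : ∀ {a b r} {A : Set a} {B : Set b} (R : A → B → Set r) zs vs {g m : ℕ → A} {m' : ℕ → B} →
  Agree zs g m → (∀ z → z ∈ zs → Σ B (R (g z))) → (∀ x → x ∈ vs → x ∉ zs → R (m x) (m' x)) →
  Σ (ℕ → B) λ g' → Agree zs g' m' × (∀ x → x ∈ vs → R (g x) (g' x))
pullback {B = B} R zs vs {g} {m} {m'} agree choose related = g' , agree' , rel
  where
  pick : ∀ x → Dec (x ∈ zs) → B
  pick x (yes x∈zs) = proj₁ (choose x x∈zs)
  pick x (no _)     = m' x
  g' : ℕ → B
  g' x = pick x (x ∈? zs)
  agree' : Agree zs g' m'
  agree' x x∉zs with x ∈? zs
  ... | yes x∈zs = ⊥-elim (x∉zs x∈zs)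
  ... | no _     = refl
  rel : ∀ x → x ∈ vs → R (g x) (g' x)
  rel x x∈vs with x ∈? zs
  ... | yes x∈zs = proj₂ (choose x x∈zs)
  ... | no x∉zs  = subst (λ y → R y (m' x)) (sym (agree x x∉zs)) (related x x∈vs x∉zs)

≐-outside : ∀ {D : Set} zs {n1 G m1 : ℕ → D → Set} → Agree zs n1 m1 → Agree zs G m1 → (∀ Z → Z ∈ zs → n1 Z ≐ G Z) →
  ∀ X → n1 X ≐ G X
≐-outside zs agree agree' inside X with X ∈? zs
... | yes X∈ = inside X X∈
... | no X∉  = ≡⇒≐ (trans (agree X X∉) (sym (agree' X X∉)))

lookup-injective : ∀ {a} {A : Set a} {xs : List A} → Unique xs → ∀ i j → lookup xs i ≡ lookup xs j → i ≡ j
lookup-injective (_ ∷ _) zero zero _ = refl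
lookup-injective (x≢ ∷ _) zero (suc j) eq = ⊥-elim (All.lookup x≢ (∈-lookup j) eq)
lookup-injective (x≢ ∷ _) (suc i) zero eq = ⊥-elim (All.lookup x≢ (∈-lookup i) (sym eq))
lookup-injective (_ ∷ u) (suc i) (suc j) eq = cong suc (lookup-injective u i j eq)

unique-⊆-length : ∀ {a} {A : Set a} {xs ys : List A} → Unique xs → (∀ {x} → x ∈ xs → x ∈ ys) → length xs ≤ length ys
unique-⊆-length {xs = xs} {ys} u sub with length ys ℕ.<? length xs
... | no ys≮xs = ≮⇒≥ ys≮xs
... | yes ys<xs with Fin.pigeonhole ys<xs position
  where
  position : Fin (length xs) → Fin (length ys)
  position i = Any.index (sub (∈-lookup i))
... | i , j , i<j , same = ⊥-elim (<-irrefl (cong Data.Fin.toℕ i≡j) i<j)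
  where
  at : ∀ k → lookup xs k ≡ lookup ys (Any.index (sub (∈-lookup k)))
  at k = lookup-index (sub (∈-lookup k))
  i≡j : i ≡ j
  i≡j = lookup-injective u i j (trans (at i) (trans (cong (lookup ys) same) (sym (at j))))

length-concatMap-≤ : ∀ {a b} {A : Set a} {B : Set b} (f : A → List B) xs c →
  (∀ x → x ∈ xs → length (f x) ≤ c) → length (concatMap f xs) ≤ length xs * c
length-concatMap-≤ f [] c bound = z≤n
length-concatMap-≤ f (x ∷ xs) c bound
  rewrite length-++ (f x) {concatMap f xs} =
  +-mono-≤ (bound x (here refl)) (length-concatMap-≤ f xs c (λ y p → bound y (there p)))

chosen : ∀ {p a} {P : Set p} {A : Set a} → Dec P → (P → List A) → List A
chosen (yes p) f = f p
chosen (no _)  f = []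

chosen-spec : ∀ {p a} {P : Set p} {A : Set a} (d : Dec P) (f : P → List A) → P → Σ P λ p → chosen d f ≡ f p
chosen-spec (yes p) f _ = p , refl
chosen-spec (no ¬p) f p = ⊥-elim (¬p p)

chosen-length : ∀ {p a} {P : Set p} {A : Set a} (d : Dec P) (f : P → List A) c →
  (∀ p → length (f p) ≤ c) → length (chosen d f) ≤ c
chosen-length (yes p) f c bound = bound p
chosen-length (no _)  f c bound = z≤n

-- All assignments of candidate values cs to the variables vs, with default
-- d elsewhere; later updates win, so a value is chosen for each variable.
assignments : ∀ {a} {A : Set a} → List ℕ → (ℕ → A) → List A → List (ℕ → A)
assignments []       d cs = d ∷ []
assignments (v ∷ vs) d cs = concatMap (λ c → map (λ g → upd g v c) (assignments vs d cs)) cs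

assignments-complete : ∀ {a p} {A : Set a} (P : ℕ → A → Set p) vs d (cs : List A) →
  (∀ x → x ∈ vs → Σ A λ c → c ∈ cs × P x c) →
  Σ (ℕ → A) λ g → g ∈ assignments vs d cs × Agree vs g d × (∀ x → x ∈ vs → P x (g x))
assignments-complete P [] d cs choose = d , here refl , (λ _ _ → refl) , λ _ ()
assignments-complete P (v ∷ vs) d cs choose with choose v (here refl)
... | c , c∈cs , Pvc with assignments-complete P vs d cs (λ x p → choose x (there p))
...   | g , g∈ , agree , Pg = upd g v c , member , agree' , P'
  where
  member : upd g v c ∈ assignments (v ∷ vs) d cs
  member = ∈-concatMap⁺ (λ c → map (λ g → upd g v c) (assignments vs d cs)) (Any.map (λ { refl → ∈-map⁺ (λ g → upd g v c) g∈ }) c∈cs)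
  agree' : Agree (v ∷ vs) (upd g v c) d
  agree' x x∉ = trans (upd-other g v c (λ v≡x → x∉ (here (sym v≡x)))) (agree x (λ p → x∉ (there p)))
  P' : ∀ x → x ∈ v ∷ vs → P x (upd g v c x)
  P' x x∈ with v ℕ.≟ x
  P' x x∈         | yes refl = Pvc
  P' x (here x≡v) | no v≢x   = ⊥-elim (v≢x (sym x≡v))
  P' x (there x∈) | no _     = Pg x x∈

length-assignments : ∀ {a} {A : Set a} vs d (cs : List A) → length (assignments vs d cs) ≤ length cs ^ length vs
length-assignments []       d cs = ≤-refl
length-assignments (v ∷ vs) d cs =
  length-concatMap-≤ _ cs _ (λ c _ → ≤-trans (≤-reflexive (length-map _ (assignments vs d cs)))
                                             (length-assignments vs d cs))

-- §2. Variables, sizes and the 3LQST0^R restriction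

data Sort : Set where
  ind set coll : Sort

Vars : Set → Set
Vars X = X → Sort → List ℕ

varsPC : {At : Set} → Vars At → Vars (PC At)
varsPC vars φ s = concatMap (λ a → vars a s) (atomsPC φ)

varsA0 : Vars Atom0
varsA0 (eq0 x y)     ind  = x ∷ y ∷ []
varsA0 (mem0 x X)    ind  = x ∷ []
varsA0 (mem0 x X)    set  = X ∷ []
varsA0 (enumEq xs X) ind  = toList xs
varsA0 (enumEq xs X) set  = X ∷ []
varsA0 (enumIn xs A) ind  = toList xs
varsA0 (enumIn xs A) coll = A ∷ []
varsA0 _             _    = []

varsA1 : Vars Atom1
varsA1 (eq1 X Y)  set  = X ∷ Y ∷ []
varsA1 (mem1 X A) set  = X ∷ []
varsA1 (mem1 X A) coll = A ∷ []
varsA1 _          _    = []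

varsU0 : Vars U0
varsU0 (∀₀ zs φ) ind  = toList zs ++ varsPC varsA0 φ ind
varsU0 (∀₀ zs φ) set  = varsPC varsA0 φ set
varsU0 (∀₀ zs φ) coll = varsPC varsA0 φ coll

varsL1 : Vars L1Atom
varsL1 (l1-a0 a) = varsA0 a
varsL1 (l1-a1 a) = varsA1 a
varsL1 (l1-u0 u) = varsU0 u

varsU1 : Vars U1
varsU1 (∀₁ Zs φ) ind  = varsPC varsL1 φ ind
varsU1 (∀₁ Zs φ) set  = toList Zs ++ varsPC varsL1 φ set
varsU1 (∀₁ Zs φ) coll = varsPC varsL1 φ coll

varsFA : Vars FAtom
varsFA (f-a0 a) = varsA0 a
varsFA (f-a1 a) = varsA1 a
varsFA (f-u0 u) = varsU0 u
varsFA (f-u1 u) = varsU1 u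

varsF : Vars Formula
varsF = varsPC varsFA

varsU0-body : ∀ zs φ s {x} → x ∈ varsPC varsA0 φ s → x ∈ varsU0 (∀₀ zs φ) s
varsU0-body zs φ ind  = ∈-++⁺ʳ (toList zs)
varsU0-body zs φ set  = λ x∈ → x∈
varsU0-body zs φ coll = λ x∈ → x∈

varsU1-body : ∀ Zs φ s {x} → x ∈ varsPC varsL1 φ s → x ∈ varsU1 (∀₁ Zs φ) s
varsU1-body Zs φ ind  = λ x∈ → x∈
varsU1-body Zs φ set  = ∈-++⁺ʳ (toList Zs)
varsU1-body Zs φ coll = λ x∈ → x∈

varsPC-⊆ : {At : Set} (vars : Vars At) (φ : PC At) {a : At} → a ∈ atomsPC φ → ∀ s {x} → x ∈ vars a s → x ∈ varsPC vars φ s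
varsPC-⊆ vars φ a∈φ s x∈a = ∈-concatMap⁺ _ (Any.map (λ { refl → x∈a }) a∈φ)

∈-sum : ∀ {n ns} → n ∈ ns → n ≤ sum ns
∈-sum (here refl) = m≤m+n _ _
∈-sum (there n∈ns) = ≤-trans (∈-sum n∈ns) (m≤n+m _ _)

atoms-size : {At : Set} (s : At → ℕ) (φ : PC At) → sum (map s (atomsPC φ)) ≤ sizePC s φ
atoms-size₂ : {At : Set} (s : At → ℕ) (φ χ : PC At) → sum (map s (atomsPC φ ++ atomsPC χ)) ≤ 1 + sizePC s φ + sizePC s χ

atoms-size s (atom a)  = ≤-reflexive (+-identityʳ (s a))
atoms-size s (neg φ)   = ≤-trans (atoms-size s φ) (n≤1+n _)
atoms-size s (and φ χ) = atoms-size₂ s φ χ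
atoms-size s (or φ χ)  = atoms-size₂ s φ χ
atoms-size s (imp φ χ) = atoms-size₂ s φ χ
atoms-size s (iff φ χ) = atoms-size₂ s φ χ

atoms-size₂ s φ χ rewrite map-++ s (atomsPC φ) (atomsPC χ) | sum-++ (map s (atomsPC φ)) (map s (atomsPC χ)) =
  ≤-trans (+-mono-≤ (atoms-size s φ) (atoms-size s χ)) (n≤1+n _)

atom-size : {At : Set} (s : At → ℕ) (φ : PC At) {a : At} → a ∈ atomsPC φ → s a ≤ sizePC s φ
atom-size s φ a∈φ = ≤-trans (∈-sum (∈-map⁺ s a∈φ)) (atoms-size s φ)

collect-bound : ∀ {b} {At : Set} {B : Set b} (h : At → List B) (s : At → ℕ) c (φ : PC At) →
  (∀ a → a ∈ atomsPC φ → length (h a) ≤ c * s a) → length (concatMap h (atomsPC φ)) ≤ c * sizePC s φ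
collect-bound h s c φ bound = ≤-trans (over (atomsPC φ) bound) (*-monoʳ-≤ c (atoms-size s φ))
  where
  over : ∀ as → (∀ a → a ∈ as → length (h a) ≤ c * s a) → length (concatMap h as) ≤ c * sum (map s as)
  over []       _     = z≤n
  over (a ∷ as) bound rewrite length-++ (h a) {concatMap h as} | *-distribˡ-+ c (s a) (sum (map s as)) =
    +-mono-≤ (bound a (here refl)) (over as (λ b b∈ → bound b (there b∈)))

collect-bound₁ : ∀ {b} {At : Set} {B : Set b} (h : At → List B) (s : At → ℕ) (φ : PC At) →
  (∀ a → length (h a) ≤ s a) → length (concatMap h (atomsPC φ)) ≤ sizePC s φ
collect-bound₁ h s φ bound =
  subst (_ ≤_) (*-identityˡ _) (collect-bound h s 1 φ (λ a _ → subst (_ ≤_) (sym (*-identityˡ _)) (bound a)))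

varsA0-length : ∀ a s → length (varsA0 a s) ≤ sizeA0 a
varsA0-length (eq0 x y)     ind  = s≤s (s≤s z≤n)
varsA0-length (eq0 x y)     set  = z≤n
varsA0-length (eq0 x y)     coll = z≤n
varsA0-length (mem0 x X)    ind  = s≤s z≤n
varsA0-length (mem0 x X)    set  = s≤s z≤n
varsA0-length (mem0 x X)    coll = z≤n
varsA0-length (enumEq xs X) ind  = m≤n+m _ 4
varsA0-length (enumEq xs X) set  = s≤s z≤n
varsA0-length (enumEq xs X) coll = z≤n
varsA0-length (enumIn xs A) ind  = m≤n+m _ 4
varsA0-length (enumIn xs A) set  = z≤n
varsA0-length (enumIn xs A) coll = s≤s z≤n

varsA1-length : ∀ a s → length (varsA1 a s) ≤ 3
varsA1-length (eq1 X Y)  ind  = z≤n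
varsA1-length (eq1 X Y)  set  = s≤s (s≤s z≤n)
varsA1-length (eq1 X Y)  coll = z≤n
varsA1-length (mem1 X A) ind  = z≤n
varsA1-length (mem1 X A) set  = s≤s z≤n
varsA1-length (mem1 X A) coll = s≤s z≤n

varsU0-length : ∀ u s → length (varsU0 u s) ≤ sizeU0 u
varsU0-length (∀₀ zs φ) ind rewrite length-++ (toList zs) {varsPC varsA0 φ ind} =
  +-mono-≤ (m≤m+n _ _) (collect-bound₁ _ sizeA0 φ (λ a → varsA0-length a ind))
varsU0-length (∀₀ zs φ) set  = ≤-trans (collect-bound₁ _ sizeA0 φ (λ a → varsA0-length a set)) (m≤n+m _ _)
varsU0-length (∀₀ zs φ) coll = ≤-trans (collect-bound₁ _ sizeA0 φ (λ a → varsA0-length a coll)) (m≤n+m _ _)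

varsL1-length : ∀ a s → length (varsL1 a s) ≤ sizeL1 a
varsL1-length (l1-a0 a) = varsA0-length a
varsL1-length (l1-a1 a) = varsA1-length a
varsL1-length (l1-u0 u) = varsU0-length u

varsFA-length : ∀ a s → length (varsFA a s) ≤ sizeFA a
varsFA-length (f-a0 a) = varsA0-length a
varsFA-length (f-a1 a) = varsA1-length a
varsFA-length (f-u0 u) = varsU0-length u
varsFA-length (f-u1 (∀₁ Zs φ)) ind  = ≤-trans (collect-bound₁ _ sizeL1 φ (λ a → varsL1-length a ind)) (m≤n+m _ _)
varsFA-length (f-u1 (∀₁ Zs φ)) set rewrite length-++ (toList Zs) {varsPC varsL1 φ set} =
  +-mono-≤ (m≤m+n _ _) (collect-bound₁ _ sizeL1 φ (λ a → varsL1-length a set))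
varsFA-length (f-u1 (∀₁ Zs φ)) coll = ≤-trans (collect-bound₁ _ sizeL1 φ (λ a → varsL1-length a coll)) (m≤n+m _ _)

varsF-length : ∀ ψ s → length (varsF ψ s) ≤ size ψ
varsF-length ψ s = collect-bound₁ _ sizeFA ψ (λ a → varsFA-length a s)

u1-occurs : ∀ ψ {u} → f-u1 u ∈ atomsPC ψ → u ∈ u1sOf ψ
u1-occurs ψ u∈ψ = ∈-concatMap⁺ _ (Any.map (λ { refl → here refl }) u∈ψ)

u0-occurs : ∀ Zs φ {u} → l1-u0 u ∈ atomsPC φ → u ∈ u0sOf (∀₁ Zs φ)
u0-occurs Zs φ u∈φ = ∈-concatMap⁺ _ (Any.map (λ { refl → here refl }) u∈φ)

evalPC-mapPC : {A B : Set} (f : A → B) (v : B → Set₁) (φ : PC A) → evalPC v (mapPC f φ) ≡ evalPC (v ∘ f) φ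
evalPC-mapPC f v (atom a)  = refl
evalPC-mapPC f v (neg φ)   = cong ¬_ (evalPC-mapPC f v φ)
evalPC-mapPC f v (and φ χ) = cong₂ _×_ (evalPC-mapPC f v φ) (evalPC-mapPC f v χ)
evalPC-mapPC f v (or φ χ)  = cong₂ _⊎_ (evalPC-mapPC f v φ) (evalPC-mapPC f v χ)
evalPC-mapPC f v (imp φ χ) = cong₂ (λ P Q → P → Q) (evalPC-mapPC f v φ) (evalPC-mapPC f v χ)
evalPC-mapPC f v (iff φ χ) = cong₂ (λ P Q → (P → Q) × (Q → P)) (evalPC-mapPC f v φ) (evalPC-mapPC f v χ)

bigAnd-sound : (v : FAtom → Set₁) (φs : List⁺ Formula) → evalPC v (bigAnd φs) → ∀ φ → φ ∈ toList φs → evalPC v φ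
bigAnd-sound v (φ ∷ [])      holds       _ (here refl) = holds
bigAnd-sound v (φ ∷ χ ∷ φs)  (holds , _) _ (here refl) = holds
bigAnd-sound v (φ ∷ χ ∷ φs)  (_ , rest)  ψ (there ψ∈)  = bigAnd-sound v (χ ∷ φs) rest ψ ψ∈

restriction-sound : ∀ Zs φ1 zs φ0 → Valid (rCondition (∀₁ Zs φ1) (∀₀ zs φ0)) →
  ∀ J → ¬ evalPC (λ a → ⟦ a ⟧a0 J) φ0 → ∀ z Z → z ∈ toList zs → Z ∈ toList Zs → M1 J Z (M0 J z)
restriction-sound Zs φ1 zs φ0 valid J ¬φ0 z Z z∈zs Z∈Zs =
  lower (bigAnd-sound (λ a → ⟦ a ⟧fa J) _ (valid J premise) _ member)
  where
  memberships : ℕ → List⁺ Formula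
  memberships z = Data.List.NonEmpty.map (λ Z → atom (f-a0 (mem0 z Z))) Zs
  premise : ¬ evalPC (λ a → ⟦ a ⟧fa J) (mapPC f-a0 φ0)
  premise holds = ¬φ0 (subst (λ P → P) (evalPC-mapPC f-a0 (λ a → ⟦ a ⟧fa J) φ0) holds)
  member : atom (f-a0 (mem0 z Z)) ∈ toList (Data.List.NonEmpty.concatMap memberships zs)
  member = subst (atom (f-a0 (mem0 z Z)) ∈_) (toList->>= memberships zs)
             (∈-concatMap⁺ (toList ∘ memberships) (Any.map (λ { refl → ∈-map⁺ _ Z∈Zs }) z∈zs))

ctx : (I : Interp) → (ℕ → D I) → (ℕ → D I → Set) → Interp
ctx I m0 m1 = record { D = D I ; elt = elt I ; M0 = m0 ; M1 = m1 ; M2 = M2 I }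

left : ∀ {a p} {A : Set a} {P : A → Set p} (xs : List A) {ys : List A} →
  (∀ x → x ∈ xs ++ ys → P x) → ∀ x → x ∈ xs → P x
left xs h x x∈xs = h x (∈-++⁺ˡ x∈xs)

right : ∀ {a p} {A : Set a} {P : A → Set p} (xs : List A) {ys : List A} →
  (∀ x → x ∈ xs ++ ys → P x) → ∀ x → x ∈ ys → P x
right xs h x x∈ys = h x (∈-++⁺ʳ xs x∈ys)

evalPC-cong : {At : Set} (v w : At → Set₁) (φ : PC At) → (∀ a → a ∈ atomsPC φ → v a ⇔ w a) → evalPC v φ ⇔ evalPC w φ
evalPC-cong v w (atom a)  eqv = eqv a (here refl)
evalPC-cong v w (neg φ)   eqv with evalPC-cong v w φ eqv
... | to , from = (λ ¬p p → ¬p (from p)) , (λ ¬p p → ¬p (to p))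
evalPC-cong v w (and φ χ) eqv with evalPC-cong v w φ (left (atomsPC φ) eqv) | evalPC-cong v w χ (right (atomsPC φ) eqv)
... | to , from | to' , from' = (λ (p , q) → to p , to' q) , (λ (p , q) → from p , from' q)
evalPC-cong v w (or φ χ)  eqv with evalPC-cong v w φ (left (atomsPC φ) eqv) | evalPC-cong v w χ (right (atomsPC φ) eqv)
... | to , from | to' , from' = (λ { (inj₁ p) → inj₁ (to p) ; (inj₂ q) → inj₂ (to' q) })
                              , (λ { (inj₁ p) → inj₁ (from p) ; (inj₂ q) → inj₂ (from' q) })
evalPC-cong v w (imp φ χ) eqv with evalPC-cong v w φ (left (atomsPC φ) eqv) | evalPC-cong v w χ (right (atomsPC φ) eqv)
... | to , from | to' , from' = (λ f p → to' (f (from p))) , (λ f p → from' (f (to p)))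
evalPC-cong v w (iff φ χ) eqv with evalPC-cong v w φ (left (atomsPC φ) eqv) | evalPC-cong v w χ (right (atomsPC φ) eqv)
... | to , from | to' , from' = (λ (f , g) → (λ p → to' (f (from p))) , (λ q → to (g (from' q))))
                              , (λ (f , g) → (λ p → from' (f (to p))) , (λ q → from (g (to' q))))

enumSet-cong : {D : Set} {m n : ℕ → D} (xs : List⁺ ℕ) → (∀ x → x ∈ toList xs → m x ≡ n x) → enumSet m xs ≐ enumSet n xs
enumSet-cong xs m≡n d =
  (λ p → let x , x∈ , d≡ = find p in lose x∈ (trans d≡ (m≡n x x∈))) ,
  (λ p → let x , x∈ , d≡ = find p in lose x∈ (trans d≡ (sym (m≡n x x∈))))

forall0-intro : ∀ I (P : Interp → Set₁) zs m0 m1 → (∀ g → Agree zs g m0 → P (ctx I g m1)) → forall0 zs P (ctx I m0 m1)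
forall0-intro I P []       m0 m1 h = h m0 (λ _ _ → refl)
forall0-intro I P (z ∷ zs) m0 m1 h d = forall0-intro I P zs (upd m0 z d) m1 λ g agree →
  h g (λ x x∉ → trans (agree x (x∉ ∘ there)) (upd-other m0 z d (λ z≡x → x∉ (here (sym z≡x)))))

forall0-elim : ∀ I (P : Interp → Set₁) zs m0 m1 → forall0 zs P (ctx I m0 m1) →
  ∀ g → Agree zs g m0 → Σ (ℕ → D I) λ n → (∀ x → n x ≡ g x) × P (ctx I n m1)
forall0-elim I P []       m0 m1 h g agree = m0 , (λ x → sym (agree x λ ())) , h
forall0-elim I P (z ∷ zs) m0 m1 h g agree = forall0-elim I P zs (upd m0 z (g z)) m1 (h (g z)) g agree'
  where
  agree' : Agree zs g (upd m0 z (g z))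
  agree' x x∉ with z ℕ.≟ x
  ... | yes refl = refl
  ... | no z≢x   = agree x λ { (here x≡z) → z≢x (sym x≡z) ; (there x∈) → x∉ x∈ }

forall1-intro : ∀ I (P : Interp → Set₁) Zs m0 m1 → (∀ G → Agree Zs G m1 → P (ctx I m0 G)) → forall1 Zs P (ctx I m0 m1)
forall1-intro I P []       m0 m1 h = h m1 (λ _ _ → refl)
forall1-intro I P (Z ∷ Zs) m0 m1 h S = forall1-intro I P Zs m0 (upd m1 Z S) λ G agree →
  h G (λ x x∉ → trans (agree x (x∉ ∘ there)) (upd-other m1 Z S (λ Z≡x → x∉ (here (sym Z≡x)))))

forall1-elim : ∀ I (P : Interp → Set₁) Zs m0 m1 → forall1 Zs P (ctx I m0 m1) →
  ∀ G → Agree Zs G m1 → Σ (ℕ → D I → Set) λ n → (∀ X → n X ≡ G X) × P (ctx I m0 n)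
forall1-elim I P []       m0 m1 h G agree = m1 , (λ X → sym (agree X λ ())) , h
forall1-elim I P (Z ∷ Zs) m0 m1 h G agree = forall1-elim I P Zs m0 (upd m1 Z (G Z)) (h (G Z)) G agree'
  where
  agree' : Agree Zs G (upd m1 Z (G Z))
  agree' X X∉ with Z ℕ.≟ X
  ... | yes refl = refl
  ... | no Z≢X   = agree X λ { (here X≡Z) → Z≢X (sym X≡Z) ; (there X∈) → X∉ X∈ }

binders₀ : U0 → List ℕ
binders₀ (∀₀ zs _) = toList zs

binders₁ : U1 → List ℕ
binders₁ (∀₁ Zs _) = toList Zs

Refutation₀ : (I : Interp) → U0 → (ℕ → D I) → (ℕ → D I → Set) → Set₁
Refutation₀ I (∀₀ zs φ) m0 m1 =
  Σ (ℕ → D I) λ g → Agree (toList zs) g m0 × ¬ evalPC (λ a → ⟦ a ⟧a0 (ctx I g m1)) φ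

Refutation₁ : (I : Interp) → U1 → (ℕ → D I) → (ℕ → D I → Set) → Set₁
Refutation₁ I (∀₁ Zs φ) m0 m1 =
  Σ (ℕ → D I → Set) λ G → Agree (toList Zs) G m1 × ¬ evalPC (λ a → ⟦ a ⟧l1 (ctx I m0 G)) φ

refute₀ : ExcludedMiddle (lsuc 0ℓ) → ∀ I u m0 m1 → ¬ ⟦ u ⟧u0 (ctx I m0 m1) → Refutation₀ I u m0 m1
refute₀ em I (∀₀ zs φ) m0 m1 ¬u = byContradiction em λ ¬r →
  ¬u (forall0-intro I _ (toList zs) m0 m1 λ g agree → byContradiction em λ ¬φ → ¬r (g , agree , ¬φ))

refute₁ : ExcludedMiddle (lsuc 0ℓ) → ∀ I u m0 m1 → ¬ ⟦ u ⟧u1 (ctx I m0 m1) → Refutation₁ I u m0 m1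
refute₁ em I (∀₁ Zs φ) m0 m1 ¬u = byContradiction em λ ¬r →
  ¬u (forall1-intro I _ (toList Zs) m0 m1 λ G agree → byContradiction em λ ¬φ → ¬r (G , agree , ¬φ))

-- §4. Transfer of truth along an embedding of interpretations

-- I' embeds into I: points via an injective map emb, subsets via `extend`,
-- which reflects points, respects extensional equality, is exact on
-- enumerations of at most K points and preserves membership in the
-- collections singled out by Coll.  (Only the domains and collections of I
-- and I' matter; assignments are supplied separately.)
record Embedding (I I' : Interp) (K : ℕ) (Coll : ℕ → Set) : Set₁ where
  field
    emb         : D I' → D I
    emb-inj     : ∀ {a b} → emb a ≡ emb b → a ≡ b
    extend      : (D I' → Set) → (D I → Set)
    extend-emb  : ∀ T b → extend T (emb b) ⇔ T b
    extend-≐    : ∀ {T T'} → T ≐ T' → extend T ≐ extend T'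
    extend-enum : ∀ (m : ℕ → D I') xs → length⁺ xs ≤ K → extend (enumSet m xs) ≐ enumSet (emb ∘ m) xs
    extend-coll : ∀ A → Coll A → ∀ T → (T ∈C M2 I' A) ⇔ (extend T ∈C M2 I A)

-- Truth is preserved along an embedding at related assignments, provided
-- false universal formulae can be refuted inside the image (the
-- `Witnessed` conditions below).
module Transfer (em : ExcludedMiddle (lsuc 0ℓ)) {I I' : Interp} {K : ℕ} {Coll : ℕ → Set}
                (E : Embedding I I' K Coll) where
  open Embedding E

  record Match (vs : Sort → List ℕ) (m0 : ℕ → D I) (m1 : ℕ → D I → Set) (m0' : ℕ → D I') (m1' : ℕ → D I' → Set) : Set where
    constructor matching
    field
      points : ∀ x → x ∈ vs ind → m0 x ≡ emb (m0' x)
      sets   : ∀ X → X ∈ vs set → m1 X ≐ extend (m1' X)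
      colls  : ∀ A → A ∈ vs coll → Coll A
  open Match

  Match-⊆ : ∀ {vs ws m0 m1 m0' m1'} → (∀ s {x} → x ∈ ws s → x ∈ vs s) → Match vs m0 m1 m0' m1' → Match ws m0 m1 m0' m1'
  Match-⊆ sub (matching r0 r1 r2) = matching (λ x p → r0 x (sub ind p)) (λ X p → r1 X (sub set p)) (λ A p → r2 A (sub coll p))

  Match-upd0 : ∀ {vs m0 m1 m0' m1'} w b → Match vs m0 m1 m0' m1' → Match vs (upd m0 w (emb b)) m1 (upd m0' w b) m1'
  Match-upd0 w b (matching r0 r1 r2) =
    matching (λ x x∈ → upd-pointwise (λ d d' → d ≡ emb d') w x refl (λ _ → r0 x x∈)) r1 r2

  Match-upd1 : ∀ {vs m0 m1 m0' m1'} W T → Match vs m0 m1 m0' m1' → Match vs m0 (upd m1 W (extend T)) m0' (upd m1' W T)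
  Match-upd1 W T (matching r0 r1 r2) =
    matching r0 (λ X X∈ → upd-pointwise (λ S S' → S ≐ extend S') W X ≐-refl (λ _ → r1 X X∈)) r2

  transferPC : ∀ {At : Set} (vars : Vars At) (⟦_⟧ : At → Interp → Set₁) (φ : PC At) {m0 m1 m0' m1'} →
    (∀ a → a ∈ atomsPC φ → Match (vars a) m0 m1 m0' m1' → ⟦ a ⟧ (ctx I m0 m1) ⇔ ⟦ a ⟧ (ctx I' m0' m1')) →
    Match (varsPC vars φ) m0 m1 m0' m1' →
    evalPC (λ a → ⟦ a ⟧ (ctx I m0 m1)) φ ⇔ evalPC (λ a → ⟦ a ⟧ (ctx I' m0' m1')) φ
  transferPC vars ⟦_⟧ φ atoms match =
    evalPC-cong _ _ φ λ a a∈φ → atoms a a∈φ (Match-⊆ (varsPC-⊆ vars φ a∈φ) match)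

  -- Since extend reflects points, it is injective up to ≐.
  extend-reflects : ∀ {T T'} → extend T ≐ extend T' → T ≐ T'
  extend-reflects h b = (λ t → proj₁ (extend-emb _ b) (proj₁ (h (emb b)) (proj₂ (extend-emb _ b) t)))
                      , (λ t → proj₁ (extend-emb _ b) (proj₂ (h (emb b)) (proj₂ (extend-emb _ b) t)))

  ≐-transfer : ∀ {S S' T T'} → S ≐ extend T → S' ≐ extend T' → (S ≐ S') ⇔ (T ≐ T')
  ≐-transfer s s' = (λ h → extend-reflects (≐-trans (≐-sym s) (≐-trans h s')))
                  , (λ h → ≐-trans s (≐-trans (extend-≐ h) (≐-sym s')))

  ∈C-transfer : ∀ {S T} A → Coll A → S ≐ extend T → (S ∈C M2 I A) ⇔ (T ∈C M2 I' A)
  ∈C-transfer A c s = (λ h → proj₂ (extend-coll A c _) (∈C-resp s h))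
                    , (λ h → ∈C-resp (≐-sym s) (proj₁ (extend-coll A c _) h))

  enum-transfer : ∀ {m0 m0'} xs → (∀ x → x ∈ toList xs → m0 x ≡ emb (m0' x)) → length⁺ xs ≤ K →
    enumSet m0 xs ≐ extend (enumSet m0' xs)
  enum-transfer {m0' = m0'} xs r0 size = ≐-trans (enumSet-cong xs r0) (≐-sym (extend-enum m0' xs size))

  a0-tr : ∀ a {m0 m1 m0' m1'} → Match (varsA0 a) m0 m1 m0' m1' → sizeA0 a ≤ K →
    ⟦ a ⟧a0 (ctx I m0 m1) ⇔ ⟦ a ⟧a0 (ctx I' m0' m1')
  a0-tr (eq0 x y) (matching r0 _ _) _ =
    (λ (lift p) → lift (emb-inj (trans (sym (r0 x (here refl))) (trans p (r0 y (there (here refl)))))))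
    , (λ (lift p) → lift (trans (r0 x (here refl)) (trans (cong emb p) (sym (r0 y (there (here refl)))))))
  a0-tr (mem0 x X) {m1 = m1} (matching r0 r1 _) _ =
    (λ (lift p) → lift (proj₁ (extend-emb _ _) (proj₁ (r1 X (here refl) _) (subst (m1 X) (r0 x (here refl)) p))))
    , (λ (lift p) → lift (subst (m1 X) (sym (r0 x (here refl))) (proj₂ (r1 X (here refl) _) (proj₂ (extend-emb _ _) p))))
  a0-tr (enumEq xs X) (matching r0 r1 _) size with ≐-transfer (enum-transfer xs r0 (≤-trans (m≤n+m _ 4) size)) (r1 X (here refl))
  ... | to , from = (λ (lift h) → lift (to h)) , (λ (lift h) → lift (from h))
  a0-tr (enumIn xs A) (matching r0 _ r2) size =
    ∈C-transfer A (r2 A (here refl)) (enum-transfer xs r0 (≤-trans (m≤n+m _ 4) size))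

  a1-tr : ∀ a {m0 m1 m0' m1'} → Match (varsA1 a) m0 m1 m0' m1' → ⟦ a ⟧a1 (ctx I m0 m1) ⇔ ⟦ a ⟧a1 (ctx I' m0' m1')
  a1-tr (eq1 X Y) (matching _ r1 _) with ≐-transfer (r1 X (here refl)) (r1 Y (there (here refl)))
  ... | to , from = (λ (lift h) → lift (to h)) , (λ (lift h) → lift (from h))
  a1-tr (mem1 X A) (matching _ r1 r2) = ∈C-transfer A (r2 A (here refl)) (r1 X (here refl))

  body0-tr : ∀ φ {m0 m1 m0' m1'} → Match (varsPC varsA0 φ) m0 m1 m0' m1' → sizePC sizeA0 φ ≤ K →
    evalPC (λ a → ⟦ a ⟧a0 (ctx I m0 m1)) φ ⇔ evalPC (λ a → ⟦ a ⟧a0 (ctx I' m0' m1')) φ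
  body0-tr φ match size = transferPC varsA0 ⟦_⟧a0 φ (λ a a∈φ m → a0-tr a m (≤-trans (atom-size sizeA0 φ a∈φ) size)) match

  Witnessed₀ : U0 → (ℕ → D I) → (ℕ → D I → Set) → Set₁
  Witnessed₀ u m0 m1 = ¬ ⟦ u ⟧u0 (ctx I m0 m1) →
    Σ (Refutation₀ I u m0 m1) λ r → ∀ z → z ∈ binders₀ u → Σ (D I') λ b → proj₁ r z ≡ emb b

  -- A level-0 universal formula: truth in I restricts to the image; for the
  -- converse a refutation in I is pulled back to one in I'.
  u0-tr : ∀ u {m0 m1 m0' m1'} → Match (varsU0 u) m0 m1 m0' m1' → sizeU0 u ≤ K → Witnessed₀ u m0 m1 →
    ⟦ u ⟧u0 (ctx I m0 m1) ⇔ ⟦ u ⟧u0 (ctx I' m0' m1')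
  u0-tr (∀₀ zs φ) {m0} {m1} {m0'} {m1'} match size witnessed = down (toList zs) match , up
    where
    Body : Interp → Set₁
    Body J = evalPC (λ a → ⟦ a ⟧a0 J) φ
    size' : sizePC sizeA0 φ ≤ K
    size' = ≤-trans (m≤n+m _ _) size
    down : ∀ ws {n0 n0'} → Match (varsU0 (∀₀ zs φ)) n0 m1 n0' m1' → forall0 ws Body (ctx I n0 m1) → forall0 ws Body (ctx I' n0' m1')
    down []       m h   = proj₁ (body0-tr φ (Match-⊆ (varsU0-body zs φ) m) size') h
    down (w ∷ ws) m h b = down ws (Match-upd0 w b m) (h (emb b))
    up : ⟦ ∀₀ zs φ ⟧u0 (ctx I' m0' m1') → ⟦ ∀₀ zs φ ⟧u0 (ctx I m0 m1)
    up h = byContradiction em λ ¬u → refuted (witnessed ¬u)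
      where
      refuted : Σ (Refutation₀ I (∀₀ zs φ) m0 m1) (λ r → ∀ z → z ∈ toList zs → Σ (D I') λ b → proj₁ r z ≡ emb b) → ⊥
      refuted ((g , agree , ¬body) , inImage)
        with g' , agree' , related ← pullback (λ d b → d ≡ emb b) (toList zs) (varsU0 (∀₀ zs φ) ind) agree inImage
                                               (λ x x∈ _ → points match x x∈)
        with n , n≡g' , body ← forall0-elim I' Body (toList zs) m0' m1' h g' agree'
        = ¬body (proj₂ (body0-tr φ (Match-⊆ (varsU0-body zs φ) (matching related' (sets match) (colls match))) size') body)
        where
        related' : ∀ x → x ∈ varsU0 (∀₀ zs φ) ind → g x ≡ emb (n x)
        related' x x∈ = trans (related x x∈) (cong emb (sym (n≡g' x)))

  body1-tr : ∀ φ {m0 m1 m0' m1'} → Match (varsPC varsL1 φ) m0 m1 m0' m1' → sizePC sizeL1 φ ≤ K →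
    (∀ u → l1-u0 u ∈ atomsPC φ → Witnessed₀ u m0 m1) →
    evalPC (λ a → ⟦ a ⟧l1 (ctx I m0 m1)) φ ⇔ evalPC (λ a → ⟦ a ⟧l1 (ctx I' m0' m1')) φ
  body1-tr φ match size witnessed = transferPC varsL1 ⟦_⟧l1 φ atom-tr match
    where
    atom-tr : ∀ a → a ∈ atomsPC φ → _ → _
    atom-tr (l1-a0 a) a∈φ m = a0-tr a m (≤-trans (atom-size sizeL1 φ a∈φ) size)
    atom-tr (l1-a1 a) a∈φ m = a1-tr a m
    atom-tr (l1-u0 u) a∈φ m = u0-tr u m (≤-trans (atom-size sizeL1 φ a∈φ) size) (witnessed u a∈φ)

  Witnessed₁ : U1 → (ℕ → D I) → (ℕ → D I → Set) → Set₁
  Witnessed₁ u m0 m1 = ¬ ⟦ u ⟧u1 (ctx I m0 m1) →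
    Σ (Refutation₁ I u m0 m1) λ r → ∀ Z → Z ∈ binders₁ u → Σ (D I' → Set) λ T → proj₁ r Z ≐ extend T

  NestedWitnessed : U1 → (ℕ → D I) → (ℕ → D I → Set) → Set₁
  NestedWitnessed (∀₁ Zs φ) m0 m1 = ∀ (n1 : ℕ → D I → Set) (n1' : ℕ → D I' → Set) → (∀ X → X ∈ varsU1 (∀₁ Zs φ) set → n1 X ≐ extend (n1' X)) →
    Agree (toList Zs) n1 m1 → ∀ u → l1-u0 u ∈ atomsPC φ → Witnessed₀ u m0 n1

  -- A level-1 universal formula, as for level 0; along the way every set
  -- assignment reached in I is read back from one in I'.
  u1-tr : ∀ u {m0 m1 m0' m1'} → Match (varsU1 u) m0 m1 m0' m1' → sizeFA (f-u1 u) ≤ K →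
    NestedWitnessed u m0 m1 → Witnessed₁ u m0 m1 → ⟦ u ⟧u1 (ctx I m0 m1) ⇔ ⟦ u ⟧u1 (ctx I' m0' m1')
  u1-tr (∀₁ Zs φ) {m0} {m1} {m0'} {m1'} match size nested witnessed = down (toList Zs) (λ p → p) match (λ _ _ → refl) , up
    where
    Body : Interp → Set₁
    Body J = evalPC (λ a → ⟦ a ⟧l1 J) φ
    size' : sizePC sizeL1 φ ≤ K
    size' = ≤-trans (m≤n+m _ _) size
    down : ∀ ws {n1 n1'} → (∀ {X} → X ∈ ws → X ∈ toList Zs) → Match (varsU1 (∀₁ Zs φ)) m0 n1 m0' n1' →
      Agree (toList Zs) n1 m1 → forall1 ws Body (ctx I m0 n1) → forall1 ws Body (ctx I' m0' n1')
    down [] _ m agree h = proj₁ (body1-tr φ (Match-⊆ (varsU1-body Zs φ) m) size' (nested _ _ (sets m) agree)) h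
    down (W ∷ ws) {n1} ws⊆ m agree h T = down ws (ws⊆ ∘ there) (Match-upd1 W T m) agree' (h (extend T))
      where
      agree' : Agree (toList Zs) (upd n1 W (extend T)) m1
      agree' X X∉ = trans (upd-other n1 W _ λ W≡X → X∉ (subst (_∈ toList Zs) W≡X (ws⊆ (here refl))))
                          (agree X X∉)
    up : ⟦ ∀₁ Zs φ ⟧u1 (ctx I' m0' m1') → ⟦ ∀₁ Zs φ ⟧u1 (ctx I m0 m1)
    up h = byContradiction em λ ¬u → refuted (witnessed ¬u)
      where
      refuted : Σ (Refutation₁ I (∀₁ Zs φ) m0 m1) (λ r → ∀ Z → Z ∈ toList Zs → Σ (D I' → Set) λ T → proj₁ r Z ≐ extend T) → ⊥
      refuted ((G , agree , ¬body) , inImage)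
        with G' , agree' , related ← pullback (λ S T → S ≐ extend T) (toList Zs) (varsU1 (∀₁ Zs φ) set) agree inImage
                                               (λ X X∈ _ → sets match X X∈)
        with n , n≡G' , body ← forall1-elim I' Body (toList Zs) m0' m1' h G' agree'
        = ¬body (proj₂ (body1-tr φ (Match-⊆ (varsU1-body Zs φ) (matching (points match) related' (colls match))) size' (nested G n related' agree)) body)
        where
        related' : ∀ X → X ∈ varsU1 (∀₁ Zs φ) set → G X ≐ extend (n X)
        related' X X∈ = ≐-trans (related X X∈) (≡⇒≐ (cong extend (sym (n≡G' X))))

  ⊨-tr : ∀ ψ {m0 m1 m0' m1'} → Match (varsF ψ) m0 m1 m0' m1' → size ψ ≤ K →
    (∀ u → f-u0 u ∈ atomsPC ψ → Witnessed₀ u m0 m1) →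
    (∀ u → f-u1 u ∈ atomsPC ψ → NestedWitnessed u m0 m1 × Witnessed₁ u m0 m1) →
    (ctx I m0 m1 ⊨ ψ) ⇔ (ctx I' m0' m1' ⊨ ψ)
  ⊨-tr ψ match size witnessed₀ witnessed₁ = transferPC varsFA ⟦_⟧fa ψ atom-tr match
    where
    atom-tr : ∀ a → a ∈ atomsPC ψ → _ → _
    atom-tr (f-a0 a) a∈ψ m = a0-tr a m (≤-trans (atom-size sizeFA ψ a∈ψ) size)
    atom-tr (f-a1 a) a∈ψ m = a1-tr a m
    atom-tr (f-u0 u) a∈ψ m = u0-tr u m (≤-trans (atom-size sizeFA ψ a∈ψ) size) (witnessed₀ u a∈ψ)
    atom-tr (f-u1 u) a∈ψ m = u1-tr u m (≤-trans (atom-size sizeFA ψ a∈ψ) size)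
                                   (proj₁ (witnessed₁ u a∈ψ)) (proj₂ (witnessed₁ u a∈ψ))

-- §5. Surjective embeddings and coincidence

-- When every point and every subset of I is represented in I', refutations
-- can always be taken inside the image, so truth transfers unconditionally.
module SurjectiveTransfer (em : ExcludedMiddle (lsuc 0ℓ)) {I I' : Interp} {K : ℕ} {Coll : ℕ → Set}
  (E : Embedding I I' K Coll)
  (emb-onto : ∀ d → Σ (D I') λ b → d ≡ Embedding.emb E b)
  (extend-onto : ∀ S → Σ (D I' → Set) λ T → S ≐ Embedding.extend E T) where
  open Transfer em E public

  witnessed₀ : ∀ u m0 m1 → Witnessed₀ u m0 m1
  witnessed₀ u m0 m1 ¬u = refute₀ em I u m0 m1 ¬u , λ z _ → emb-onto _

  body1-transfer : ∀ φ {m0 m1 m0' m1'} → Match (varsPC varsL1 φ) m0 m1 m0' m1' → sizePC sizeL1 φ ≤ K →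
    evalPC (λ a → ⟦ a ⟧l1 (ctx I m0 m1)) φ ⇔ evalPC (λ a → ⟦ a ⟧l1 (ctx I' m0' m1')) φ
  body1-transfer φ {m0} {m1} match size = body1-tr φ match size (λ u _ → witnessed₀ u m0 m1)

  ⊨-transfer : ∀ ψ {m0 m1 m0' m1'} → Match (varsF ψ) m0 m1 m0' m1' → size ψ ≤ K → (ctx I m0 m1 ⊨ ψ) ⇔ (ctx I' m0' m1' ⊨ ψ)
  ⊨-transfer ψ {m0} {m1} match size = ⊨-tr ψ match size (λ u _ → witnessed₀ u m0 m1) (λ u _ → nested u , witnessed₁ u)
    where
    nested : ∀ u → NestedWitnessed u m0 m1
    nested (∀₁ Zs φ) n1 _ _ _ u _ = witnessed₀ u m0 n1
    witnessed₁ : ∀ u → Witnessed₁ u m0 m1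
    witnessed₁ u ¬u = refute₁ em I u m0 m1 ¬u , λ Z _ → extend-onto _

withM2 : (I : Interp) → (ℕ → (D I → Set) → Set) → Interp
withM2 I M2' = record { D = D I ; elt = elt I ; M0 = M0 I ; M1 = M1 I ; M2 = M2' }

identity : ∀ I (M2' : ℕ → (D I → Set) → Set) K (Coll : ℕ → Set) →
  (∀ A → Coll A → ∀ T → (T ∈C M2' A) ⇔ (T ∈C M2 I A)) → Embedding I (withM2 I M2') K Coll
identity I M2' K Coll same = record
  { emb = λ d → d ; emb-inj = λ eq → eq ; extend = λ T → T ; extend-emb = λ _ _ → (λ t → t) , (λ t → t)
  ; extend-≐ = λ h → h ; extend-enum = λ _ _ _ → ≐-refl ; extend-coll = same }

-- Coincidence: truth in I depends only on the values of the occurring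
-- variables, and on the values of set variables only up to ≐.
module Coincidence (em : ExcludedMiddle (lsuc 0ℓ)) (I : Interp) (K : ℕ) =
  SurjectiveTransfer em (identity I (M2 I) K (λ _ → ⊤) (λ _ _ _ → (λ h → h) , (λ h → h)))
                     (λ d → d , refl) (λ S → S , ≐-refl)

coincide₀ : ExcludedMiddle (lsuc 0ℓ) → ∀ I u {m0 : ℕ → D I} {m1 m1' : ℕ → D I → Set} → (∀ X → m1 X ≐ m1' X) →
  (⟦ u ⟧u0 (ctx I m0 m1) ⇔ ⟦ u ⟧u0 (ctx I m0 m1')) × (Refutation₀ I u m0 m1' → Refutation₀ I u m0 m1)
coincide₀ em I (∀₀ zs φ) {m0} m1≐m1' =
  C.u0-tr (∀₀ zs φ) same ≤-refl (C.witnessed₀ (∀₀ zs φ) m0 _) ,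
  λ (g , agree , ¬body) → g , agree , λ body → ¬body (proj₁ (C.body0-tr φ same (m≤n+m _ _)) body)
  where
  module C = Coincidence em I (sizeU0 (∀₀ zs φ))
  same : ∀ {vs m0} → C.Match vs m0 _ m0 _
  same = C.matching (λ _ _ → refl) (λ X _ → m1≐m1' X) (λ _ _ → tt)

module Selection (em0 : ExcludedMiddle 0ℓ) {D : Set} where

  sample : (D → Set) → ℕ → List D
  sample S zero = []
  sample S (suc k) with em0 {Σ D λ d → S d × d ∉ sample S k}
  ... | yes (d , _) = d ∷ sample S k
  ... | no _        = sample S k

  sample-length : ∀ S k → length (sample S k) ≤ k
  sample-length S zero = z≤n
  sample-length S (suc k) with em0 {Σ D λ d → S d × d ∉ sample S k}
  ... | yes _ = s≤s (sample-length S k)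
  ... | no _  = ≤-trans (sample-length S k) (n≤1+n k)

  sample-spec : ∀ S k → All S (sample S k) × Unique (sample S k) ×
                        (length (sample S k) ≡ k ⊎ (∀ d → S d → d ∈ sample S k))
  sample-spec S zero = [] , [] , inj₁ refl
  sample-spec S (suc k) with sample-spec S k | em0 {Σ D λ d → S d × d ∉ sample S k}
  ... | inS , unique , inj₁ len  | yes (d , Sd , d∉) = Sd ∷ inS , ¬Any⇒All¬ _ d∉ ∷ unique , inj₁ (cong suc len)
  ... | inS , unique , inj₂ all  | yes (d , Sd , d∉) = Sd ∷ inS , ¬Any⇒All¬ _ d∉ ∷ unique , inj₂ (λ d' Sd' → there (all d' Sd'))
  ... | inS , unique , _         | no none =
    inS , unique , inj₂ (λ d Sd → byContradiction₀ em0 (λ d∉ → none (d , Sd , d∉)))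

  separator : (D → Set) → (D → Set) → List D
  separator S S' = chosen (em0 {Σ D λ d → ¬ (S d ⇔ S' d)}) (λ (d , _) → d ∷ [])

  separator-spec : ∀ S S' → ¬ (S ≐ S') → Σ D λ d → d ∈ separator S S' × ¬ (S d ⇔ S' d)
  separator-spec S S' S≠S' with chosen-spec (em0 {Σ D λ d → ¬ (S d ⇔ S' d)}) (λ (d , _) → d ∷ []) separated
    where
    separated : Σ D λ d → ¬ (S d ⇔ S' d)
    separated = byContradiction₀ em0 λ none → S≠S' λ d → byContradiction₀ em0 λ ¬iff → none (d , ¬iff)
  ... | (d , ¬iff) , eq = d , subst (d ∈_) (sym eq) (here refl) , ¬iff

  separator-length : ∀ S S' → length (separator S S') ≤ 1
  separator-length S S' = chosen-length (em0 {Σ D λ d → ¬ (S d ⇔ S' d)}) _ 1 (λ _ → ≤-refl)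

-- §7. The small model

bound : ℕ → ℕ
bound K = suc K + ((K + K) * suc K + ((K + K) * ((K + K) * 1) + (K + suc (K + K) ^ K * K)))

module SmallModel (em0 : ExcludedMiddle 0ℓ) (em1 : ExcludedMiddle (lsuc 0ℓ)) (ψ : Formula) (inR : InR ψ) (I : Interp) where
  open Selection em0

  -- Enumerations in ψ have at most K points.
  K : ℕ
  K = size ψ

  refutingPoints : U0 → (ℕ → D I → Set) → List (D I)
  refutingPoints u m1 = chosen (em1 {Refutation₀ I u (M0 I) m1}) (λ r → map (proj₁ r) (binders₀ u))

  refutingPoints-spec : ∀ u m1 → ¬ ⟦ u ⟧u0 (ctx I (M0 I) m1) →
    Σ (Refutation₀ I u (M0 I) m1) λ r → ∀ z → z ∈ binders₀ u → proj₁ r z ∈ refutingPoints u m1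
  refutingPoints-spec u m1 ¬u
    with r , eq ← chosen-spec (em1 {Refutation₀ I u (M0 I) m1}) (λ r → map (proj₁ r) (binders₀ u)) (refute₀ em1 I u (M0 I) m1 ¬u)
    = r , λ z z∈ → subst (proj₁ r z ∈_) (sym eq) (∈-map⁺ (proj₁ r) z∈)

  refutingSets : U1 → List (D I → Set)
  refutingSets u = chosen (em1 {Refutation₁ I u (M0 I) (M1 I)}) (λ r → map (proj₁ r) (binders₁ u))

  refutingSets-spec : ∀ u → ¬ ⟦ u ⟧u1 (ctx I (M0 I) (M1 I)) →
    Σ (Refutation₁ I u (M0 I) (M1 I)) λ r → ∀ Z → Z ∈ binders₁ u → proj₁ r Z ∈ refutingSets u
  refutingSets-spec u ¬u
    with r , eq ← chosen-spec (em1 {Refutation₁ I u (M0 I) (M1 I)}) (λ r → map (proj₁ r) (binders₁ u)) (refute₁ em1 I u (M0 I) (M1 I) ¬u)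
    = r , λ Z Z∈ → subst (proj₁ r Z ∈_) (sym eq) (∈-map⁺ (proj₁ r) Z∈)

  -- The relevant subsets: values of the set variables of ψ and the sets of
  -- the chosen refutations of its level-1 formulae.
  setsOf : FAtom → List (D I → Set)
  setsOf (f-u1 u) = refutingSets u
  setsOf _        = []

  family : List (D I → Set)
  family = map (M1 I) (varsF ψ set) ++ concatMap setsOf (atomsPC ψ)

  topPoints : FAtom → List (D I)
  topPoints (f-u0 u) = refutingPoints u (M1 I)
  topPoints _        = []

  nestedOf : List ℕ → L1Atom → List (D I)
  nestedOf Zs (l1-u0 u) = concatMap (refutingPoints u) (assignments Zs (M1 I) family)
  nestedOf Zs _         = []

  nestedPoints : FAtom → List (D I)
  nestedPoints (f-u1 (∀₁ Zs φ)) = concatMap (nestedOf (toList Zs)) (atomsPC φ)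
  nestedPoints _                = []

  freePoints samples separators top nested points : List (D I)
  freePoints = elt I ∷ map (M0 I) (varsF ψ ind)
  samples    = concatMap (λ S → sample S (suc K)) family
  separators = concatMap (λ S → concatMap (separator S) family) family
  top        = concatMap topPoints (atomsPC ψ)
  nested     = concatMap nestedPoints (atomsPC ψ)
  points     = freePoints ++ samples ++ separators ++ top ++ nested

  in-samples : ∀ {S d} → S ∈ family → d ∈ sample S (suc K) → d ∈ points
  in-samples S∈ d∈ = ∈-++⁺ʳ freePoints (∈-++⁺ˡ (∈-concatMap⁺ _ (Any.map (λ { refl → d∈ }) S∈)))

  in-separators : ∀ {S S' d} → S ∈ family → S' ∈ family → d ∈ separator S S' → d ∈ points
  in-separators S∈ S'∈ d∈ = ∈-++⁺ʳ freePoints (∈-++⁺ʳ samples (∈-++⁺ˡ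
    (∈-concatMap⁺ _ (Any.map (λ { refl → ∈-concatMap⁺ _ (Any.map (λ { refl → d∈ }) S'∈) }) S∈))))

  in-top : ∀ {a d} → a ∈ atomsPC ψ → d ∈ topPoints a → d ∈ points
  in-top a∈ d∈ = ∈-++⁺ʳ freePoints (∈-++⁺ʳ samples (∈-++⁺ʳ separators (∈-++⁺ˡ
    (∈-concatMap⁺ _ (Any.map (λ { refl → d∈ }) a∈)))))

  in-nested : ∀ {a d} → a ∈ atomsPC ψ → d ∈ nestedPoints a → d ∈ points
  in-nested a∈ d∈ = ∈-++⁺ʳ freePoints (∈-++⁺ʳ samples (∈-++⁺ʳ separators (∈-++⁺ʳ top
    (∈-concatMap⁺ _ (Any.map (λ { refl → d∈ }) a∈)))))

  -- The domain of the small model: positions in the list of collected points.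
  _≟D_ : (d d' : D I) → Dec (d ≡ d')
  d ≟D d' = em0 {d ≡ d'}

  universe : List (D I)
  universe = deduplicate _≟D_ points

  n : ℕ
  n = length universe

  emb : Fin n → D I
  emb = lookup universe

  emb-inj : ∀ {i j} → emb i ≡ emb j → i ≡ j
  emb-inj = lookup-injective (deduplicate-! _≟D_ points) _ _

  inImage : ∀ {d} → d ∈ points → Σ (Fin n) λ i → d ≡ emb i
  inImage d∈ = Any.index (∈-deduplicate⁺ _≟D_ d∈) , lookup-index (∈-deduplicate⁺ _≟D_ d∈)

  elt* : Fin n
  elt* = proj₁ (inImage (here refl))

  preimage : D I → Fin n
  preimage d with em0 {Σ (Fin n) λ i → d ≡ emb i}
  ... | yes (i , _) = i
  ... | no _        = elt*

  preimage-spec : ∀ {d} → d ∈ points → d ≡ emb (preimage d)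
  preimage-spec {d} d∈ with em0 {Σ (Fin n) λ i → d ≡ emb i}
  ... | yes (i , d≡) = d≡
  ... | no none      = ⊥-elim (none (inImage d∈))

  -- Subsets of the small domain are read back in I as the relevant subset
  -- they restrict, if any, and as their own image otherwise.
  restrict : (D I → Set) → Fin n → Set
  restrict S i = S (emb i)

  Relevant : (Fin n → Set) → Set₁
  Relevant T = Any (λ S → T ≐ restrict S) family

  image : (Fin n → Set) → D I → Set
  image T d = Σ (Fin n) λ i → d ≡ emb i × T i

  extendBy : (T : Fin n → Set) → Dec (Relevant T) → D I → Set
  extendBy T (yes relevant) = proj₁ (find relevant)
  extendBy T (no _)         = image T

  extend : (Fin n → Set) → D I → Set
  extend T = extendBy T (em1 {Relevant T})

  -- Relevant subsets are determined by their restrictions, thanks to the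
  -- separating points.
  family-separated : ∀ {S S'} → S ∈ family → S' ∈ family → restrict S ≐ restrict S' → S ≐ S'
  family-separated {S} {S'} S∈ S'∈ same = byContradiction₀ em0 λ S≠S' →
    let d , d∈ , ¬iff = separator-spec S S' S≠S'
        i , d≡ = inImage (in-separators S∈ S'∈ d∈)
    in ¬iff ((λ Sd → subst S' (sym d≡) (proj₁ (same i) (subst S d≡ Sd)))
           , (λ S'd → subst S (sym d≡) (proj₂ (same i) (subst S' d≡ S'd))))

  extend-family : ∀ {S} → S ∈ family → extend (restrict S) ≐ S
  extend-family {S} S∈ with em1 {Relevant (restrict S)}
  ... | yes relevant = let _ , S'∈ , same = find relevant in family-separated S'∈ S∈ (≐-sym same)
  ... | no irrelevant = ⊥-elim (irrelevant (Any.map (λ { refl → ≐-refl }) S∈))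

  extend-emb : ∀ T i → extend T (emb i) ⇔ T i
  extend-emb T i with em1 {Relevant T}
  ... | yes relevant = let _ , _ , same = find relevant in proj₂ (same i) , proj₁ (same i)
  ... | no _         = (λ (j , eq , Tj) → subst T (sym (emb-inj eq)) Tj) , (λ Ti → i , refl , Ti)

  extendBy-≐ : ∀ {T T'} → T ≐ T' → (r : Dec (Relevant T)) (r' : Dec (Relevant T')) → extendBy T r ≐ extendBy T' r'
  extendBy-≐ T≐T' (yes rel) (yes rel') =
    let _ , S∈ , T≐S = find rel ; _ , S'∈ , T'≐S' = find rel'
    in family-separated S∈ S'∈ (≐-trans (≐-sym T≐S) (≐-trans T≐T' T'≐S'))
  extendBy-≐ T≐T' (yes rel) (no irr') = ⊥-elim (irr' (Any.map (≐-trans (≐-sym T≐T')) rel))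
  extendBy-≐ T≐T' (no irr) (yes rel') = ⊥-elim (irr (Any.map (≐-trans T≐T') rel'))
  extendBy-≐ T≐T' (no _) (no _) d = (λ (i , eq , Ti) → i , eq , proj₁ (T≐T' i) Ti)
                                  , (λ (i , eq , Ti) → i , eq , proj₂ (T≐T' i) Ti)

  extend-≐ : ∀ {T T'} → T ≐ T' → extend T ≐ extend T'
  extend-≐ {T} {T'} T≐T' = extendBy-≐ T≐T' (em1 {Relevant T}) (em1 {Relevant T'})

  extend-irrelevant : ∀ T → ¬ Relevant T → ∀ d → extend T d → Σ (Fin n) λ i → d ≡ emb i
  extend-irrelevant T irr d with em1 {Relevant T}
  ... | yes rel = ⊥-elim (irr rel)
  ... | no _    = λ (i , eq , _) → i , eq

  -- For a relevant S this uses the samples: if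
  -- S had more than K points, K+1 of them would be listed in the
  -- enumeration.
  extend-enum : ∀ (m : ℕ → Fin n) xs → length⁺ xs ≤ K → extend (enumSet m xs) ≐ enumSet (emb ∘ m) xs
  extend-enum m xs short with em1 {Relevant (enumSet m xs)}
  ... | no _ = λ d → (λ (i , d≡ , i∈) → Any.map (λ i≡ → trans d≡ (cong emb i≡)) i∈)
                   , (λ d∈ → let x , x∈ , d≡ = find d∈ in m x , d≡ , lose x∈ refl)
  ... | yes relevant with find relevant
  ...   | S , S∈ , T≐S = λ d → covered (sample-spec S (suc K)) d , listed⁻
    where
    listed : ∀ {d} → d ∈ points → S d → enumSet (emb ∘ m) xs d
    listed d∈ Sd = let i , d≡ = inImage d∈ in Any.map (λ i≡ → trans d≡ (cong emb i≡)) (proj₂ (T≐S i) (subst S d≡ Sd))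
    listed⁻ : ∀ {d} → enumSet (emb ∘ m) xs d → S d
    listed⁻ d∈ = let x , x∈ , d≡ = find d∈ in subst S (sym d≡) (proj₁ (T≐S (m x)) (lose x∈ refl))
    covered : All S (sample S (suc K)) × Unique (sample S (suc K)) ×
              (length (sample S (suc K)) ≡ suc K ⊎ (∀ d → S d → d ∈ sample S (suc K))) →
              ∀ d → S d → enumSet (emb ∘ m) xs d
    covered (_ , _ , inj₂ all) d Sd = listed (in-samples S∈ (all d Sd)) Sd
    covered (inS , unique , inj₁ full) d Sd = ⊥-elim (<-irrefl refl (≤-trans too-many short))
      where
      too-many : suc K ≤ length⁺ xs
      too-many = subst₂ _≤_ full (length-map (emb ∘ m) (toList xs))
        (unique-⊆-length unique λ d∈ → map⁺ (listed (in-samples S∈ d∈) (All.lookup inS d∈)))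

  -- The collections of the small model: T belongs to A iff its reading back does.
  M2* : ℕ → (Fin n → Set) → Set
  M2* A T = True (em1 {extend T ∈C M2 I A})

  I* : Interp
  I* = record { D = Fin n ; elt = elt* ; M0 = preimage ∘ M0 I ; M1 = restrict ∘ M1 I ; M2 = M2* }

  embedding : Embedding I I* K (λ _ → ⊤)
  embedding = record
    { emb = emb ; emb-inj = emb-inj ; extend = extend ; extend-emb = extend-emb ; extend-≐ = extend-≐
    ; extend-enum = extend-enum
    ; extend-coll = λ A _ T → (λ (T' , T'∈ , T'≐T) → ∈C-resp (extend-≐ T'≐T) (toWitness T'∈))
                            , (λ h → T , fromWitness h , ≐-refl) }

  open Transfer em1 embedding using (Match; matching; Witnessed₀; Witnessed₁; NestedWitnessed; ⊨-tr)

  top-match : Match (varsF ψ) (M0 I) (M1 I) (preimage ∘ M0 I) (restrict ∘ M1 I)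
  top-match = matching (λ x x∈ → preimage-spec (∈-++⁺ˡ (there (∈-map⁺ (M0 I) x∈))))
                       (λ X X∈ → ≐-sym (extend-family (∈-++⁺ˡ (∈-map⁺ (M1 I) X∈))))
                       (λ _ _ → tt)

  top-witnessed : ∀ u → f-u0 u ∈ atomsPC ψ → Witnessed₀ u (M0 I) (M1 I)
  top-witnessed u u∈ ¬u = let r , r∈ = refutingPoints-spec u (M1 I) ¬u in r , λ z z∈ → inImage (in-top u∈ (r∈ z z∈))

  u1-witnessed : ∀ u → f-u1 u ∈ atomsPC ψ → Witnessed₁ u (M0 I) (M1 I)
  u1-witnessed u u∈ ¬u = let r , r∈ = refutingSets-spec u ¬u in
    r , λ Z Z∈ → restrict (proj₁ r Z) , ≐-sym (extend-family (∈-++⁺ʳ (map (M1 I) (varsF ψ set))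
                                            (∈-concatMap⁺ setsOf (Any.map (λ { refl → r∈ Z Z∈ }) u∈))))

  RelatedAt : U1 → (ℕ → D I → Set) → (ℕ → Fin n → Set) → Set
  RelatedAt u n1 n1' = ∀ X → X ∈ varsU1 u set → n1 X ≐ extend (n1' X)

  -- If some quantified set is irrelevant, it lies inside the image, and by
  -- the 3LQST0^R restriction so does every point of a refutation.
  through-irrelevant : ∀ Zs φ → f-u1 (∀₁ Zs φ) ∈ atomsPC ψ → ∀ n1 n1' → RelatedAt (∀₁ Zs φ) n1 n1' →
    ∀ Z → Z ∈ toList Zs → ¬ Relevant (n1' Z) → ∀ u0 → l1-u0 u0 ∈ atomsPC φ → Witnessed₀ u0 (M0 I) n1
  through-irrelevant Zs φ u∈ψ n1 n1' related Z Z∈ irrelevant (∀₀ zs φ0) u0∈φ ¬u0 =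
    let r@(g , _ , ¬φ0) = refute₀ em1 I (∀₀ zs φ0) (M0 I) n1 ¬u0
        valid = inR (∀₁ Zs φ) (u1-occurs ψ u∈ψ) (∀₀ zs φ0) (u0-occurs Zs φ u0∈φ)
        inZ : ∀ z → z ∈ toList zs → n1 Z (g z)
        inZ z z∈ = restriction-sound Zs φ zs φ0 valid (ctx I g n1) ¬φ0 z Z z∈ Z∈
    in r , λ z z∈ → extend-irrelevant (n1' Z) irrelevant (g z) (proj₁ (related Z (∈-++⁺ˡ Z∈) (g z)) (inZ z z∈))

  relevant-assignment : ∀ Zs φ n1 n1' → RelatedAt (∀₁ Zs φ) n1 n1' → Agree (toList Zs) n1 (M1 I) →
    (∀ Z → Z ∈ toList Zs → Relevant (n1' Z)) →
    Σ (ℕ → D I → Set) λ G → G ∈ assignments (toList Zs) (M1 I) family × (∀ X → n1 X ≐ G X)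
  relevant-assignment Zs φ n1 n1' related agree relevant =
    let G , G∈ , agreeG , n1≐G = assignments-complete (λ Z S → n1 Z ≐ S) (toList Zs) (M1 I) family choice
    in G , G∈ , ≐-outside (toList Zs) agree agreeG n1≐G
    where
    choice : ∀ Z → Z ∈ toList Zs → Σ (D I → Set) λ S → S ∈ family × n1 Z ≐ S
    choice Z Z∈ = let S , S∈ , n1'Z≐S = find (relevant Z Z∈)
                  in S , S∈ , ≐-trans (related Z (∈-++⁺ˡ Z∈)) (≐-trans (extend-≐ n1'Z≐S) (extend-family S∈))

  -- In that case a refutation at the enumerated assignment is among the
  -- nested points.
  through-relevant : ∀ Zs φ → f-u1 (∀₁ Zs φ) ∈ atomsPC ψ → ∀ n1 n1' → RelatedAt (∀₁ Zs φ) n1 n1' →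
    Agree (toList Zs) n1 (M1 I) → (∀ Z → Z ∈ toList Zs → Relevant (n1' Z)) →
    ∀ u0 → l1-u0 u0 ∈ atomsPC φ → Witnessed₀ u0 (M0 I) n1
  through-relevant Zs φ u∈ψ n1 n1' related agree relevant (∀₀ zs φ0) u0∈φ ¬u0 =
    let G , G∈ , n1≐G = relevant-assignment Zs φ n1 n1' related agree relevant
        coincide = coincide₀ em1 I (∀₀ zs φ0) n1≐G
        r , r∈ = refutingPoints-spec (∀₀ zs φ0) G (¬u0 ∘ proj₂ (proj₁ coincide))
    in proj₂ coincide r , λ z z∈ → inImage (in-nested u∈ψ
         (∈-concatMap⁺ _ (Any.map (λ { refl → ∈-concatMap⁺ _ (Any.map (λ { refl → r∈ z z∈ }) G∈) }) u0∈φ)))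

  nested-witnessed : ∀ u → f-u1 u ∈ atomsPC ψ → NestedWitnessed u (M0 I) (M1 I)
  nested-witnessed (∀₁ Zs φ) u∈ψ n1 n1' related agree u0 u0∈φ
    with em1 {∀ Z → Z ∈ toList Zs → Relevant (n1' Z)}
  ... | yes relevant = through-relevant Zs φ u∈ψ n1 n1' related agree relevant u0 u0∈φ
  ... | no ¬relevant =
    let Z , Z∈ , irrelevant = byContradiction em1 λ none →
          ¬relevant λ Z Z∈ → byContradiction em1 λ irr → none (Z , Z∈ , irr)
    in through-irrelevant Zs φ u∈ψ n1 n1' related Z Z∈ irrelevant u0 u0∈φ

  binders-length : ∀ {a} {A : Set a} (f : ℕ → A) (zs : List⁺ ℕ) b → length (map f (toList zs)) ≤ 2 * length⁺ zs + b
  binders-length f zs b = ≤-trans (≤-reflexive (length-map f (toList zs))) (≤-trans (m≤m+n _ _) (m≤m+n _ b))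

  refutingPoints-length : ∀ u m1 → length (refutingPoints u m1) ≤ sizeU0 u
  refutingPoints-length (∀₀ zs φ) m1 =
    chosen-length (em1 {Refutation₀ I (∀₀ zs φ) (M0 I) m1}) (λ r → map (proj₁ r) (toList zs)) _ λ r → binders-length (proj₁ r) zs _

  setsOf-length : ∀ a → length (setsOf a) ≤ sizeFA a
  setsOf-length (f-u1 (∀₁ Zs φ)) =
    chosen-length (em1 {Refutation₁ I (∀₁ Zs φ) (M0 I) (M1 I)}) (λ r → map (proj₁ r) (toList Zs)) _ λ r → binders-length (proj₁ r) Zs _
  setsOf-length (f-a0 _) = z≤n
  setsOf-length (f-a1 _) = z≤n
  setsOf-length (f-u0 _) = z≤n

  topPoints-length : ∀ a → length (topPoints a) ≤ sizeFA a
  topPoints-length (f-u0 u) = refutingPoints-length u (M1 I)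
  topPoints-length (f-a0 _) = z≤n
  topPoints-length (f-a1 _) = z≤n
  topPoints-length (f-u1 _) = z≤n

  family-length : length family ≤ K + K
  family-length rewrite length-++ (map (M1 I) (varsF ψ set)) {concatMap setsOf (atomsPC ψ)}
                      | length-map (M1 I) (varsF ψ set) =
    +-mono-≤ (varsF-length ψ set) (collect-bound₁ setsOf sizeFA ψ setsOf-length)

  nestedPoints-length : ∀ a → a ∈ atomsPC ψ → length (nestedPoints a) ≤ suc (K + K) ^ K * sizeFA a
  nestedPoints-length (f-u1 (∀₁ Zs φ)) u∈ψ =
    ≤-trans (collect-bound (nestedOf (toList Zs)) sizeL1 (length family ^ length⁺ Zs) φ nestedOf-length)
            (*-mono-≤ (≤-trans (^-monoˡ-≤ (length⁺ Zs) (≤-trans family-length (n≤1+n _)))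
                               (^-monoʳ-≤ (suc (K + K)) Zs≤K))
                      (m≤n+m _ _))
    where
    Zs≤K : length⁺ Zs ≤ K
    Zs≤K = ≤-trans (≤-trans (m≤m+n _ _) (m≤m+n _ _)) (atom-size sizeFA ψ u∈ψ)
    nestedOf-length : ∀ a → a ∈ atomsPC φ → length (nestedOf (toList Zs) a) ≤ length family ^ length⁺ Zs * sizeL1 a
    nestedOf-length (l1-u0 u) _ =
      ≤-trans (length-concatMap-≤ (refutingPoints u) (assignments (toList Zs) (M1 I) family) (sizeU0 u) (λ G _ → refutingPoints-length u G))
              (*-monoˡ-≤ (sizeU0 u) (length-assignments (toList Zs) (M1 I) family))
    nestedOf-length (l1-a0 _) _ = z≤n
    nestedOf-length (l1-a1 _) _ = z≤n
  nestedPoints-length (f-a0 _) _ = z≤n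
  nestedPoints-length (f-a1 _) _ = z≤n
  nestedPoints-length (f-u0 _) _ = z≤n

  points-length : length points ≤ bound K
  points-length
    rewrite length-++ freePoints {samples ++ separators ++ top ++ nested} | length-++ samples {separators ++ top ++ nested}
          | length-++ separators {top ++ nested} | length-++ top {nested} =
    +-mono-≤ (s≤s (≤-trans (≤-reflexive (length-map (M0 I) (varsF ψ ind))) (varsF-length ψ ind)))
   (+-mono-≤ (≤-trans (length-concatMap-≤ _ family (suc K) (λ S _ → sample-length S (suc K)))
                      (*-monoˡ-≤ (suc K) family-length))
   (+-mono-≤ (≤-trans (length-concatMap-≤ _ family (length family * 1)
                        (λ S _ → length-concatMap-≤ (separator S) family 1 (λ S' _ → separator-length S S')))
                      (*-mono-≤ family-length (*-monoˡ-≤ 1 family-length)))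
   (+-mono-≤ (collect-bound₁ topPoints sizeFA ψ topPoints-length)
             (collect-bound nestedPoints sizeFA (suc (K + K) ^ K) ψ nestedPoints-length))))

  domain-size : n ≤ bound K
  domain-size = ≤-trans (length-deduplicate _≟D_ points) points-length

  small : I ⊨ ψ → I* ⊨ ψ
  small = proj₁ (⊨-tr ψ top-match ≤-refl top-witnessed (λ u u∈ → nested-witnessed u u∈ , u1-witnessed u u∈))

small-model : ExcludedMiddle 0ℓ → ExcludedMiddle (lsuc 0ℓ) →
  ∀ ψ → InR ψ → Satisfiable ψ → SatisfiableWithin (bound (size ψ)) ψ
small-model em0 em1 ψ inR (I , sat) =
  SM.I* , SM.n , SM.domain-size , mk↔ₛ′ (λ i → i) (λ i → i) (λ _ → refl) (λ _ → refl) , SM.small sat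
  where module SM = SmallModel em0 em1 ψ inR I

-- §8. Coded finite interpretations and decidable truth

-- An interpretation over Fin (suc N) coded by finite data: subsets are
-- Boolean functions and collections are lists of them.
record Code (N : ℕ) : Set where
  constructor code
  field
    c0 : ℕ → Fin (suc N)
    c1 : ℕ → Fin (suc N) → Bool
    c2 : ℕ → List (Fin (suc N) → Bool)
open Code

⟪_⟫ : ∀ {m} → (Fin m → Bool) → Fin m → Set
⟪ v ⟫ d = T (v d)

decode : ∀ {N} → Code N → Interp
decode {N} c = record { D = Fin (suc N) ; elt = zero ; M0 = c0 c ; M1 = λ X → ⟪ c1 c X ⟫
                      ; M2 = λ A S → Any (λ v → S ≐ ⟪ v ⟫) (c2 c A) }

set0 : ∀ {N} → Code N → ℕ → Fin (suc N) → Code N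
set0 c z i = code (upd (c0 c) z i) (c1 c) (c2 c)

set1 : ∀ {N} → Code N → ℕ → (Fin (suc N) → Bool) → Code N
set1 c Z v = code (c0 c) (upd (c1 c) Z v) (c2 c)

-- All Boolean functions on Fin m, each up to pointwise equality.
allFuns : ∀ m → List (Fin m → Bool)
allFuns zero    = (λ ()) ∷ []
allFuns (suc m) = concatMap (λ b → map (b V.∷_) (allFuns m)) (true ∷ false ∷ [])

allFuns-complete : ∀ m (f : Fin m → Bool) → Σ (Fin m → Bool) λ g → g ∈ allFuns m × (∀ i → g i ≡ f i)
allFuns-complete zero    f = _ , here refl , λ ()
allFuns-complete (suc m) f with allFuns-complete m (f ∘ suc)
... | g , g∈ , g≡ = f zero V.∷ g , member (f zero) , λ { zero → refl ; (suc i) → g≡ i }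
  where
  member : ∀ b → (b V.∷ g) ∈ allFuns (suc m)
  member true  = ∈-++⁺ˡ (∈-map⁺ (true V.∷_) g∈)
  member false = ∈-++⁺ʳ (map (true V.∷_) (allFuns m)) (∈-++⁺ˡ (∈-map⁺ (false V.∷_) g∈))

boolean : ExcludedMiddle 0ℓ → ∀ {m} (S : Fin m → Set) → Σ (Fin m → Bool) λ v → v ∈ allFuns m × ⟪ v ⟫ ≐ S
boolean em S = let g , g∈ , g≡ = allFuns-complete _ (λ d → isYes (em {S d}))
               in g , g∈ , λ d → (λ t → toWitness {a? = em {S d}} (subst T (g≡ d) t))
                                , (λ s → subst T (sym (g≡ d)) (fromWitness {a? = em {S d}} s))

≐? : ∀ {m} {S S' : Fin m → Set} → (∀ d → Dec (S d)) → (∀ d → Dec (S' d)) → Dec (S ≐ S')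
≐? S? S'? = Fin.all? λ d → (S? d →-dec S'? d) ×-dec (S'? d →-dec S? d)

enumSet? : ∀ {m} (g : ℕ → Fin m) xs d → Dec (enumSet g xs d)
enumSet? g xs d = Any.any? (λ x → d Fin.≟ g x) (toList xs)

∈C? : ∀ {N} (c : Code N) {S : Fin (suc N) → Set} A → (∀ d → Dec (S d)) → Dec (S ∈C M2 (decode c) A)
∈C? c A S? = map′ (λ v∈ → let v , v∈ , v≐S = find v∈ in ⟪ v ⟫ , Any.map (λ { refl → ≐-refl }) v∈ , v≐S)
                  (λ (T , T∈ , T≐S) → let v , v∈ , T≐v = find T∈ in lose v∈ (≐-trans (≐-sym T≐v) T≐S))
                  (Any.any? (λ v → ≐? (λ d → T? (v d)) S?) (c2 c A))

evalPC? : ∀ {At : Set} {v : At → Set₁} (φ : PC At) → (∀ a → Dec (v a)) → Dec (evalPC v φ)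
evalPC? (atom a)  v? = v? a
evalPC? (neg φ)   v? = ¬? (evalPC? φ v?)
evalPC? (and φ χ) v? = evalPC? φ v? ×-dec evalPC? χ v?
evalPC? (or φ χ)  v? = evalPC? φ v? ⊎-dec evalPC? χ v?
evalPC? (imp φ χ) v? = evalPC? φ v? →-dec evalPC? χ v?
evalPC? (iff φ χ) v? = (evalPC? φ v? →-dec evalPC? χ v?) ×-dec (evalPC? χ v? →-dec evalPC? φ v?)

a0? : ∀ {N} (c : Code N) a → Dec (⟦ a ⟧a0 (decode c))
a0? c (eq0 x y)     = map′ lift lower (c0 c x Fin.≟ c0 c y)
a0? c (mem0 x X)    = map′ lift lower (T? (c1 c X (c0 c x)))
a0? c (enumEq xs X) = map′ lift lower (≐? (enumSet? (c0 c) xs) (λ d → T? (c1 c X d)))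
a0? c (enumIn xs A) = ∈C? c A (enumSet? (c0 c) xs)

a1? : ∀ {N} (c : Code N) a → Dec (⟦ a ⟧a1 (decode c))
a1? c (eq1 X Y)  = map′ lift lower (≐? (λ d → T? (c1 c X d)) (λ d → T? (c1 c Y d)))
a1? c (mem1 X A) = ∈C? c A (λ d → T? (c1 c X d))

forall0? : ∀ {N} zs (P : Interp → Set₁) → (∀ (c : Code N) → Dec (P (decode c))) → ∀ (c : Code N) → Dec (forall0 zs P (decode c))
forall0? []       P P? c = P? c
forall0? (z ∷ zs) P P? c = Fin.all? λ i → forall0? zs P P? (set0 c z i)

u0? : ∀ {N} (c : Code N) u → Dec (⟦ u ⟧u0 (decode c))
u0? c (∀₀ zs φ) = forall0? (toList zs) _ (λ c' → evalPC? φ (a0? c')) c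

l1? : ∀ {N} (c : Code N) a → Dec (⟦ a ⟧l1 (decode c))
l1? c (l1-a0 a) = a0? c a
l1? c (l1-a1 a) = a1? c a
l1? c (l1-u0 u) = u0? c u

-- Set quantifiers restricted to Boolean subsets; decidable, and classically
-- equivalent to the unrestricted ones (§9).
forall1ᵇ : ∀ {N} → List ℕ → (Code N → Set₁) → Code N → Set₁
forall1ᵇ         []       P c = P c
forall1ᵇ {N} (Z ∷ Zs) P c = All (λ v → forall1ᵇ Zs P (set1 c Z v)) (allFuns (suc N))

forall1ᵇ? : ∀ {N} Zs (P : Code N → Set₁) → (∀ c → Dec (P c)) → ∀ c → Dec (forall1ᵇ Zs P c)
forall1ᵇ? []       P P? c = P? c
forall1ᵇ? (Z ∷ Zs) P P? c = All.all? (λ v → forall1ᵇ? Zs P P? (set1 c Z v)) _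

⟦_⟧ᵇ : ∀ {N} → FAtom → Code N → Set₁
⟦ f-a0 a ⟧ᵇ c = ⟦ a ⟧a0 (decode c)
⟦ f-a1 a ⟧ᵇ c = ⟦ a ⟧a1 (decode c)
⟦ f-u0 u ⟧ᵇ c = ⟦ u ⟧u0 (decode c)
⟦ f-u1 (∀₁ Zs φ) ⟧ᵇ c = forall1ᵇ (toList Zs) (λ c' → evalPC (λ a → ⟦ a ⟧l1 (decode c')) φ) c

fa? : ∀ {N} (c : Code N) a → Dec (⟦ a ⟧ᵇ c)
fa? c (f-a0 a) = a0? c a
fa? c (f-a1 a) = a1? c a
fa? c (f-u0 u) = u0? c u
fa? c (f-u1 (∀₁ Zs φ)) = forall1ᵇ? (toList Zs) _ (λ c' → evalPC? φ (l1? c')) c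

_⊨ᵇ_ : ∀ {N} → Code N → Formula → Set₁
c ⊨ᵇ ψ = evalPC (λ a → ⟦ a ⟧ᵇ c) ψ

⊨ᵇ? : ∀ {N} (c : Code N) ψ → Dec (c ⊨ᵇ ψ)
⊨ᵇ? c ψ = evalPC? ψ (fa? c)

-- §9. Correctness of the evaluation and the decision procedure

Invariant : (Interp → Set₁) → Set₁
Invariant P = ∀ J (m1 m1' : ℕ → D J → Set) → (∀ X → m1 X ≐ m1' X) → P (ctx J (M0 J) m1) → P (ctx J (M0 J) m1')

forall1-invariant : ∀ Zs P → Invariant P → Invariant (forall1 Zs P)
forall1-invariant []       P inv = inv
forall1-invariant (Z ∷ Zs) P inv J m1 m1' same h S =
  forall1-invariant Zs P inv J (upd m1 Z S) (upd m1' Z S) (λ X → upd-pointwise (λ A B → A ≐ B) Z X ≐-refl (λ _ → same X)) (h S)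

body1-invariant : ExcludedMiddle (lsuc 0ℓ) → ∀ φ → Invariant (λ J → evalPC (λ a → ⟦ a ⟧l1 J) φ)
body1-invariant em φ J m1 m1' same =
  proj₁ (C.body1-transfer φ (C.matching (λ _ _ → refl) (λ X _ → same X) (λ _ _ → tt)) ≤-refl)
  where module C = Coincidence em J (sizePC sizeL1 φ)

forall1ᵇ-correct : ExcludedMiddle 0ℓ → ∀ {N} Zs (P : Interp → Set₁) → Invariant P →
  ∀ (c : Code N) → forall1ᵇ Zs (P ∘ decode) c ⇔ forall1 Zs P (decode c)
forall1ᵇ-correct em []       P inv c = (λ h → h) , (λ h → h)
forall1ᵇ-correct em (Z ∷ Zs) P inv c = to , from
  where
  inv' = forall1-invariant Zs P inv (decode c)
  to : forall1ᵇ (Z ∷ Zs) (P ∘ decode) c → forall1 (Z ∷ Zs) P (decode c)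
  to h S = let v , v∈ , v≐S = boolean em S in
    inv' _ _ (λ X → upd-pointwise (λ b A → ⟪ b ⟫ ≐ A) Z X v≐S (λ _ → ≐-refl))
         (proj₁ (forall1ᵇ-correct em Zs P inv (set1 c Z v)) (All.lookup h v∈))
  from : forall1 (Z ∷ Zs) P (decode c) → forall1ᵇ (Z ∷ Zs) (P ∘ decode) c
  from h = All.tabulate λ {v} _ → proj₂ (forall1ᵇ-correct em Zs P inv (set1 c Z v))
    (inv' _ _ (λ X → upd-pointwise (λ A b → A ≐ ⟪ b ⟫) Z X ≐-refl (λ _ → ≐-refl)) (h ⟪ v ⟫))

⊨ᵇ-correct : ExcludedMiddle 0ℓ → ExcludedMiddle (lsuc 0ℓ) → ∀ {N} (c : Code N) ψ → c ⊨ᵇ ψ ⇔ decode c ⊨ ψ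
⊨ᵇ-correct em0 em1 c ψ = evalPC-cong _ _ ψ atom-correct
  where
  atom-correct : ∀ a → a ∈ atomsPC ψ → ⟦ a ⟧ᵇ c ⇔ ⟦ a ⟧fa (decode c)
  atom-correct (f-a0 a) _ = (λ h → h) , (λ h → h)
  atom-correct (f-a1 a) _ = (λ h → h) , (λ h → h)
  atom-correct (f-u0 u) _ = (λ h → h) , (λ h → h)
  atom-correct (f-u1 (∀₁ Zs φ)) _ = forall1ᵇ-correct em0 (toList Zs) _ (body1-invariant em1 φ) c

-- Codes of the finite interpretations relevant to ψ: the variables of ψ
-- take every possible value, all others a default one.
sublists : ∀ {a} {A : Set a} → List A → List (List A)
sublists []       = [] ∷ []
sublists (x ∷ xs) = map (x ∷_) (sublists xs) ++ sublists xs

filter-sublists : ∀ {a p} {A : Set a} {P : A → Set p} (P? : ∀ x → Dec (P x)) xs → filter P? xs ∈ sublists xs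
filter-sublists P? []       = here refl
filter-sublists P? (x ∷ xs) with does (P? x)
... | true  = ∈-++⁺ˡ (∈-map⁺ (x ∷_) (filter-sublists P? xs))
... | false = ∈-++⁺ʳ (map (x ∷_) (sublists xs)) (filter-sublists P? xs)

codes : ∀ N → Formula → List (Code N)
codes N ψ =
  concatMap (λ m0 → concatMap (λ m1 → map (code m0 m1) (assignments (varsF ψ coll) (λ _ → []) (sublists (allFuns (suc N)))))
                              (assignments (varsF ψ set) (λ _ _ → false) (allFuns (suc N))))
            (assignments (varsF ψ ind) (λ _ → zero) (allFin (suc N)))

SmallCode : Formula → Set₁
SmallCode ψ = Any (λ N → Any (λ c → c ⊨ᵇ ψ) (codes N ψ)) (upTo (bound (size ψ)))

smallCode? : ∀ ψ → Dec (SmallCode ψ)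
smallCode? ψ = Any.any? (λ N → Any.any? (λ c → ⊨ᵇ? c ψ) (codes N ψ)) (upTo (bound (size ψ)))

decide : Formula → Bool
decide ψ = does (smallCode? ψ)

does-sound : ∀ {p} {P : Set p} (d : Dec P) → does d ≡ true → P
does-sound (yes p) _ = p

decide-sound : ExcludedMiddle 0ℓ → ExcludedMiddle (lsuc 0ℓ) → ∀ ψ → decide ψ ≡ true → Satisfiable ψ
decide-sound em0 em1 ψ accepted =
  let N , _ , found = find (does-sound (smallCode? ψ) accepted)
      c , _ , c⊨ψ = find found
  in decode c , proj₁ (⊨ᵇ-correct em0 em1 c ψ) c⊨ψ

enumerated : ExcludedMiddle (lsuc 0ℓ) → ∀ {N} ψ (b : Code N) → (∀ A → c2 b A ∈ sublists (allFuns (suc N))) →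
  Σ (Code N) λ c → c ∈ codes N ψ × (decode b ⊨ ψ → decode c ⊨ ψ)
enumerated em {N} ψ b sub =
  let m0 , m0∈ , _ , m0≡ = assignments-complete (λ x i → i ≡ c0 b x) (varsF ψ ind) (λ _ → zero) (allFin (suc N))
                             (λ x _ → c0 b x , ∈-allFin _ , refl)
      m1 , m1∈ , _ , m1≡ = assignments-complete (λ X v → ∀ i → v i ≡ c1 b X i) (varsF ψ set) (λ _ _ → false) (allFuns (suc N))
                             (λ X _ → allFuns-complete (suc N) (c1 b X))
      m2 , m2∈ , _ , m2≡ = assignments-complete (λ A l → l ≡ c2 b A) (varsF ψ coll) (λ _ → []) (sublists (allFuns (suc N)))
                             (λ A _ → c2 b A , sub A , refl)
      module S = SurjectiveTransfer em (identity (decode b) (M2 (decode (code m0 m1 m2))) (size ψ) (_∈ varsF ψ coll)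
                   (λ A A∈ T → subst (λ l → T ∈C (λ S → Any (λ v → S ≐ ⟪ v ⟫) l)) (m2≡ A A∈)
                             , subst (λ l → T ∈C (λ S → Any (λ v → S ≐ ⟪ v ⟫) l)) (sym (m2≡ A A∈))))
                   (λ d → d , refl) (λ S → S , ≐-refl)
      match = S.matching (λ x x∈ → sym (m0≡ x x∈))
                         (λ X X∈ d → subst T (sym (m1≡ X X∈ d)) , subst T (m1≡ X X∈ d))
                         (λ A A∈ → A∈)
  in code m0 m1 m2
   , ∈-concatMap⁺ _ (Any.map (λ { refl → ∈-concatMap⁺ _ (Any.map (λ { refl → ∈-map⁺ (code m0 m1) m2∈ }) m1∈) }) m0∈)
   , proj₁ (S.⊨-transfer ψ match ≤-refl)

-- A model whose domain is in bijection with Fin (suc N), read through the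
-- bijection as a code; this is a surjective embedding, so the code
-- satisfies the same formulae.
module FiniteModel (em0 : ExcludedMiddle 0ℓ) (em1 : ExcludedMiddle (lsuc 0ℓ)) (J : Interp) {N : ℕ}
                   (iso : D J ↔ Fin (suc N)) where
  to = Inverse.to iso
  from = Inverse.from iso
  to-from : ∀ i → to (from i) ≡ i
  to-from = Inverse.strictlyInverseˡ iso
  from-to : ∀ d → from (to d) ≡ d
  from-to = Inverse.strictlyInverseʳ iso

  inM2 : ∀ A (v : Fin (suc N) → Bool) → Dec ((⟪ v ⟫ ∘ to) ∈C M2 J A)
  inM2 A v = em1

  codeOf : Code N
  codeOf = code (to ∘ M0 J) (λ X i → isYes (em0 {M1 J X (from i)})) (λ A → filter (inM2 A) (allFuns (suc N)))

  codeOf-collections : ∀ A → c2 codeOf A ∈ sublists (allFuns (suc N))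
  codeOf-collections A = filter-sublists (inM2 A) (allFuns (suc N))

  embedding : ∀ K → Embedding J (decode codeOf) K (λ _ → ⊤)
  embedding K = record
    { emb = from
    ; emb-inj = λ {a} {b} eq → trans (sym (to-from a)) (trans (cong to eq) (to-from b))
    ; extend = λ T → T ∘ to
    ; extend-emb = λ T i → subst T (to-from i) , subst T (sym (to-from i))
    ; extend-≐ = λ T≐T' d → T≐T' (to d)
    ; extend-enum = λ m xs _ d → Any.map (λ eq → trans (sym (from-to d)) (cong from eq))
                               , Any.map (λ eq → trans (cong to eq) (to-from _))
    ; extend-coll = λ A _ T → (λ (T' , T'∈ , T'≐T) → let v , v∈ , T'≐v = find T'∈
                                 in ∈C-resp (λ d → ≐-trans (≐-sym T'≐v) T'≐T (to d))
                                            (proj₂ (∈-filter⁻ (inM2 A) {xs = allFuns (suc N)} v∈)))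
                            , (λ h → let v , v∈ , v≐T = boolean em0 T
                                 in T , lose (∈-filter⁺ (inM2 A) v∈ (∈C-resp (λ d → ≐-sym v≐T (to d)) h)) (≐-sym v≐T) , ≐-refl)
    }

  codeOf-satisfies : ∀ ψ → J ⊨ ψ → decode codeOf ⊨ ψ
  codeOf-satisfies ψ = proj₁ (S.⊨-transfer ψ match ≤-refl)
    where
    module S = SurjectiveTransfer em1 (embedding (size ψ)) (λ d → to d , sym (from-to d))
                 (λ S → S ∘ from , λ d → subst S (sym (from-to d)) , subst S (from-to d))
    match = S.matching (λ x _ → sym (from-to (M0 J x)))
                       (λ X _ d → (λ m → fromWitness {a? = em0 {M1 J X (from (to d))}} (subst (M1 J X) (sym (from-to d)) m))
                                , (λ t → subst (M1 J X) (from-to d) (toWitness {a? = em0 {M1 J X (from (to d))}} t)))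
                       (λ _ _ → tt)

coded : ExcludedMiddle 0ℓ → ExcludedMiddle (lsuc 0ℓ) → ∀ ψ J {N} → D J ↔ Fin (suc N) → J ⊨ ψ →
  Σ (Code N) λ c → c ∈ codes N ψ × decode c ⊨ ψ
coded em0 em1 ψ J iso J⊨ψ =
  let c , c∈ , transfer = enumerated em1 ψ F.codeOf F.codeOf-collections
  in c , c∈ , transfer (F.codeOf-satisfies ψ J⊨ψ)
  where module F = FiniteModel em0 em1 J iso

-- Completeness on 3LQST0^R: a satisfiable formula has a model with at most
-- `bound (size ψ)` points, whose code is enumerated.
decide-complete : ExcludedMiddle 0ℓ → ExcludedMiddle (lsuc 0ℓ) → ∀ ψ → InR ψ → Satisfiable ψ → decide ψ ≡ true
decide-complete em0 em1 ψ inR sat with small-model em0 em1 ψ inR sat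
... | J , zero  , _       , iso , _   = ⊥-elim (Fin.¬Fin0 (Inverse.to iso (elt J)))
... | J , suc N , N<bound , iso , J⊨ψ =
  let c , c∈ , c⊨ψ = coded em0 em1 ψ J iso J⊨ψ
  in dec-true (smallCode? ψ) (lose (∈-upTo⁺ N<bound) (lose c∈ (proj₂ (⊨ᵇ-correct em0 em1 c ψ) c⊨ψ)))

corollary4p3 :
  Σ (ℕ → ℕ) λ f →
  Σ (Formula → Bool) λ decide →
    (ExcludedMiddle 0ℓ → ExcludedMiddle (lsuc 0ℓ) →
      ∀ ψ → InR ψ → Satisfiable ψ → SatisfiableWithin (f (size ψ)) ψ)
    ×
    (ExcludedMiddle 0ℓ → ExcludedMiddle (lsuc 0ℓ) →
      ∀ ψ → InR ψ → (decide ψ ≡ true → Satisfiable ψ) × (Satisfiable ψ → decide ψ ≡ true))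
corollary4p3 =
  bound , decide , small-model ,
  λ em0 em1 ψ inR → decide-sound em0 em1 ψ , decide-complete em0 em1 ψ inR
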